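{- Let $\sigma\in\Sigma$, $\mathfrak R=(\varphi_{j_1},\dots,\varphi_{j_n})$ a refinement and $i\in\{1,\dots,n-1\}$. The linear map $f_{i,\sigma}:\mathrm{Hom}^i_{\mathrm{Fil},\mathfrak R}(D_\sigma,D_\sigma)\to\mathrm{Hom}_\sigma(\mathrm{GL}_i(\mathcal O_K)\times\mathrm{GL}_{n-i}(\mathcal O_K),E)$ is an isomorphism if and only if the simple reflection $s_i$ does not appear in some (equivalently any) reduced expression of $w_{\mathfrak R,\sigma}w_0$.
   Context: $K/\mathbb{Q}_p$ finite, $E/\mathbb{Q}_p$ finite, $\sigma:K\hookrightarrow E$. $D_\sigma$ is an $n$-dimensional $E$-vector space ($n\ge2$) with an $E$-linear operator $\varphi^f$ with pairwise distinct eigenvalues $\varphi_0,\dots,\varphi_{n-1}$ (in fact $\varphi_j\varphi_k^{ -1}\notin\{1,p^f\}$ for $j\ne k$), a basis $e_0,\dots,e_{n-1}$ with $\varphi^f(e_j)=\varphi_je_j$, and a full-flag filtration $\mathrm{Fil}^{ -h_{j,\sigma}}(D_\sigma)$, $h_{0,\sigma}>\dots>h_{n-1,\sigma}$, $\dim\mathrm{Fil}^{ -h_{j,\sigma}}(D_\sigma)=n-j$; $\mathrm{Hom}_{\mathrm{Fil}}(D_\sigma,D_\sigma)$ denotes the endomorphisms preserving each step. A refinement is an ordering $\mathfrak R=(\varphi_{j_1},\dots,\varphi_{j_n})$ of the eigenvalues; put $e'_k:=e_{j_k}$. Let $g\in\mathrm{GL}_n(E)$ be such that, in the basis $(e'_1,\dots,e'_n)$,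 the span of the first $k$ columns of $g$ is $\mathrm{Fil}^{ -h_{n-k,\sigma}}(D_\sigma)$ for $k=1,\dots,n$, and let $w_{\mathfrak R,\sigma}\in S_n$ be the unique permutation with $g\in B(E)\dot wB(E)$, where $B$ is the upper triangular Borel and $\dot w$ the permutation matrix with $\dot we_k=e_{w(k)}$ (standard basis). $s_i=(i,i+1)$ and $w_0$ is the longest element of $S_n$. $\mathrm{Hom}^i_{\mathrm{Fil},\mathfrak R}(D_\sigma,D_\sigma)$ is the set of $f\in\mathrm{Hom}_{\mathrm{Fil}}(D_\sigma,D_\sigma)$ for which there exist $a,b\in E$ with $f(e'_k)=ae'_k$ for $1\le k\le i$ and $f(e'_k)-be'_k\in\bigoplus_{l=1}^iEe'_l$ for $i<k\le n$ (the scalars $a,b$ are then uniquely determined by $f$). $\mathrm{Hom}_\sigma(\mathrm{GL}_i(\mathcal O_K)\times\mathrm{GL}_{n-i}(\mathcal O_K),E)$ is the ($2$-dimensional) space of locally $\sigma$-analytic group homomorphisms to $(E,+)$, and $f_{i,\sigma}(f)$ is the homomorphism $(g_1,g_2)\mapsto a\,\sigma(\log\det g_1)+b\,\sigma(\log\det g_2)$. -}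

module Defs where

open import Level using (Level; _⊔_) renaming (suc to lsuc)
open import Algebra.Bundles using (CommutativeRing)
open import Data.Nat.Base using (ℕ; zero; suc; _≤_; _<_)
open import Data.Fin.Base using (Fin; toℕ; inject₁; opposite)
open import Data.Fin.Properties using (_≟_)
open import Data.Fin.Permutation using (Permutation′; transpose; _⟨$⟩ʳ_)
open import Data.List.Base using (List; []; _∷_; length)
open import Data.List.Membership.Propositional using (_∈_)
open import Data.Product using (Σ; ∃; _×_; _,_)
open import Relation.Nullary using (¬_; yes; no)
open import Relation.Binary.PropositionalEquality using (_≡_)
import Algebra.Properties.Monoid.Sum as MonoidSum

record Field (c ℓ : Level) : Set (lsuc (c ⊔ ℓ)) where
  field
    commutativeRing : CommutativeRing c ℓ
  open CommutativeRing commutativeRing public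
  field
    0≉1 : ¬ (0# ≈ 1#)
    inverse : ∀ x → ¬ (x ≈ 0#) → ∃ λ y → x * y ≈ 1#

-- Words in the simple reflections of S_n, n = suc m.
-- A generator j : Fin m stands for the paper's s_{toℕ j + 1}, i.e. the
-- transposition of the (0-indexed) positions j and j+1.

simpleRefl : ∀ {m} → Fin m → Permutation′ (suc m)
simpleRefl j = transpose (inject₁ j) (Fin.suc j)

w₀ : ∀ {n} → Fin n → Fin n
w₀ = opposite

evalWord : ∀ {m} → List (Fin m) → Fin (suc m) → Fin (suc m)
evalWord []       k = k
evalWord (j ∷ js) k = simpleRefl j ⟨$⟩ʳ evalWord js k

IsReducedExpression : ∀ {m} → List (Fin m) → (Fin (suc m) → Fin (suc m)) → Set
IsReducedExpression {m} ws π =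
  (∀ k → evalWord ws k ≡ π k) ×
  (∀ (vs : List (Fin m)) → (∀ k → evalWord vs k ≡ π k) → length ws ≤ length vs)

-- Linear algebra over a field, in coordinates w.r.t. the basis (e'_1,…,e'_n).

module _ {c ℓ} (F : Field c ℓ) where
  open Field F
  open MonoidSum +-monoid using (sum)

  Vect : ℕ → Set c
  Vect n = Fin n → Carrier

  Mat : ℕ → Set c
  Mat n = Fin n → Fin n → Carrier

  _≋_ : ∀ {n} → Mat n → Mat n → Set ℓ
  M ≋ N = ∀ r s → M r s ≈ N r s

  δ : ∀ {n} → Fin n → Fin n → Carrier
  δ r s with r ≟ s
  ... | yes _ = 1#
  ... | no  _ = 0#

  idMat : ∀ {n} → Mat n
  idMat = δ

  _·_ : ∀ {n} → Mat n → Mat n → Mat n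
  (M · N) r s = sum (λ t → M r t * N t s)

  _⋆_ : ∀ {n} → Mat n → Vect n → Vect n
  (M ⋆ v) r = sum (λ t → M r t * v t)

  Invertible : ∀ {n} → Mat n → Set (c ⊔ ℓ)
  Invertible {n} g = Σ (Mat n) λ h → ((g · h) ≋ idMat) × ((h · g) ≋ idMat)

  UpperTriangular : ∀ {n} → Mat n → Set ℓ
  UpperTriangular b = ∀ r s → toℕ s < toℕ r → b r s ≈ 0#

  permMatrix : ∀ {n} → Permutation′ n → Mat n
  permMatrix w r s = δ r (w ⟨$⟩ʳ s)

  InBruhatCell : ∀ {n} → Mat n → Permutation′ n → Set (c ⊔ ℓ)
  InBruhatCell {n} g w = Σ (Mat n) λ b₁ → Σ (Mat n) λ b₂ →
    UpperTriangular b₁ × Invertible b₁ × UpperTriangular b₂ × Invertible b₂ ×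
    (g ≋ (b₁ · (permMatrix w · b₂)))

  InSpanFirstCols : ∀ {n} → Mat n → ℕ → Vect n → Set (c ⊔ ℓ)
  InSpanFirstCols {n} g k v = Σ (Vect n) λ coeff →
    (∀ j → k ≤ toℕ j → coeff j ≈ 0#) × (∀ r → v r ≈ sum (λ j → g r j * coeff j))

  -- M ∈ Hom_Fil(D,D): M preserves each step of the flag, where the step of
  -- dimension k (k = 1,…,n) is the span of the first k columns of g.
  PreservesFlag : ∀ {n} → Mat n → Mat n → Set (c ⊔ ℓ)
  PreservesFlag {n} g M = ∀ k → 1 ≤ k → k ≤ n → ∀ v →
    InSpanFirstCols g k v → InSpanFirstCols g k (M ⋆ v)

  -- M ∈ Hom^i_{Fil,R}(D,D) with associated scalars a, b
  -- (M e'_k is the k-th column of M; e'_1,…,e'_i are the first i columns of idMat)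
  InHomI : ∀ {n} → Mat n → ℕ → Mat n → Carrier → Carrier → Set (c ⊔ ℓ)
  InHomI g i M a b =
    PreservesFlag g M ×
    (∀ k → toℕ k < i → ∀ r → M r k ≈ a * δ r k) ×
    (∀ k → i ≤ toℕ k → InSpanFirstCols idMat i (λ r → M r k - b * δ r k))

  -- f_{i,σ} : M ↦ (a,b) (coordinates w.r.t. the basis σ∘log∘det of the two
  -- factors of Hom_σ(GL_i × GL_{n-i}, E)) is a bijective (linear) map.
  FIsIsomorphism : ∀ {n} → Mat n → ℕ → Set (c ⊔ ℓ)
  FIsIsomorphism {n} g i =
    (∀ (M M' : Mat n) a b a' b' → InHomI g i M a b → InHomI g i M' a' b' →
       a ≈ a' → b ≈ b' → M ≋ M') ×
    (∀ a b → Σ (Mat n) λ M → InHomI g i M a b)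

{-# OPTIONS --safe #-}

-- Write g = b₁ P b₂ with b₁, b₂ upper triangular and P the permutation matrix of w.  The
-- matrix of an endomorphism M in the basis b₁ P e is P⁻¹ (b₁⁻¹ M b₁) P, and M preserves the
-- flag exactly when this matrix is upper triangular.  Membership in Hom^i with scalars a, b
-- says that M − diag(a,…,a,b,…,b) is strictly block upper triangular (blocks of sizes i and
-- n − i), a condition that survives conjugation by b₁.  Hence f_i is always onto (take
-- M = b₁ diag(a,…,b) b₁⁻¹), and it is one-to-one iff no nonzero matrix is both strictly block
-- upper triangular and upper triangular after reordering by w, i.e. iff w⁻¹ places every
-- index ≥ i before every index < i.  That says that w w₀ stabilises {0,…,i−1}.
--
-- On the Coxeter side, the length of a permutation is its number of inversions: it is at
-- most the length of any word (each letter changes one inversion) and is attained by bubble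
-- sort.  If π stabilises {0,…,i−1} and a word for π contains s_i, split it at the last s_i:
-- that letter inverts a pair straddling the two blocks which π itself does not invert, so
-- the word has more letters than π has inversions and is not reduced.  Conversely a word
-- avoiding s_i only produces permutations stabilising {0,…,i−1}.

module Submission where

open import Defs hiding (_⋆_; _·_; _≋_)
open import Algebra.Bundles using (Semiring)
open import Data.Bool.Base using (Bool; true; false; _∧_)
open import Data.Nat.Base using (ℕ; zero; suc)
open import Data.Fin.Base using (Fin; toℕ; inject₁; opposite; fromℕ<)
open import Data.Fin.Permutation
  using (Permutation′; _⟨$⟩ʳ_; _⟨$⟩ˡ_; inverseˡ; inverseʳ; id; _∘ₚ_; flip; transpose; reverse)
open import Data.List.Base using (List; []; _∷_; length; _++_)
open import Data.List.Membership.Propositional using (_∈_; _∉_)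
open import Data.Product using (Σ; _×_; _,_; proj₁; proj₂)
open import Function.Base using (_∘_)
open import Function.Bundles using (_⇔_; mk⇔; Equivalence)
open import Function.Construct.Composition using (_⇔-∘_)
open import Relation.Nullary using (¬_; yes; no; Dec)
open import Relation.Nullary.Negation using (contradiction)

module SemiringSum {c ℓ} (R : Semiring c ℓ) where
  open Semiring R
  open import Data.Fin.Base using (punchIn)
  open import Data.Fin.Properties using (punchInᵢ≢i)
  open import Relation.Binary.PropositionalEquality using (_≢_)
  open import Relation.Binary.Reasoning.Setoid setoid
  open import Algebra.Properties.Semiring.Sum R public

  sum-zero : ∀ {n} (f : Fin n → Carrier) → (∀ t → f t ≈ 0#) → sum f ≈ 0#
  sum-zero {n} f f≈0 = trans (sum-cong-≋ f≈0) (sum-replicate-zero n)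

  sum-single : ∀ {n} (f : Fin n → Carrier) (p : Fin n) → (∀ t → t ≢ p → f t ≈ 0#) → sum f ≈ f p
  sum-single {suc n} f p vanishes = begin
    sum f                              ≈⟨ sum-remove {i = p} f ⟩
    f p + sum (λ t → f (punchIn p t))  ≈⟨ +-congˡ (sum-zero _ (λ t → vanishes _ (punchInᵢ≢i p t))) ⟩
    f p + 0#                           ≈⟨ +-identityʳ (f p) ⟩
    f p                                ∎

module Permutations where
  open import Data.Nat.Base using (_+_; _≤_; _<_; _<ᵇ_; z≤n; s≤s; s≤s⁻¹)
  import Data.Nat.Properties as ℕ
  open import Data.Bool.Properties using (∧-zeroʳ; not-¬)
  open import Data.Fin.Base using (inject≤; fromℕ)
  open import Data.Fin.Induction using (<-weakInduction; >-weakInduction)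
  open import Data.Fin.Properties
    using (_≟_; any?; toℕ-injective; toℕ<n; toℕ≤pred[n]; toℕ-inject₁; ≤̄⇒inject₁<; toℕ-fromℕ; toℕ-fromℕ<;
           toℕ-inject≤; opposite-prop; opposite-involutive; injective⇒≤)
  import Data.Fin.Permutation.Components as PC
  open import Data.List.Relation.Unary.Any using (here; there)
  import Data.List.Relation.Unary.Any as Any
  import Data.List.Properties as List
  open import Data.Sum using (_⊎_; inj₁; inj₂)
  open import Relation.Binary.Definitions using (tri<; tri≈; tri>)
  open import Relation.Binary.PropositionalEquality
  open import Relation.Nullary.Decidable using (dec-true; dec-false)

  open SemiringSum ℕ.+-*-semiring using (sum; sum-zero; sum-single; sum-cong-≗; ∑-distrib-+)

  <ᵇ-true : ∀ {a b} → a < b → (a <ᵇ b) ≡ true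
  <ᵇ-true {a} {b} = dec-true (a ℕ.<? b)

  <ᵇ-false : ∀ {a b} → ¬ a < b → (a <ᵇ b) ≡ false
  <ᵇ-false {a} {b} = dec-false (a ℕ.<? b)

  sum-mono-≤ : ∀ {n} {f g : Fin n → ℕ} → (∀ x → f x ≤ g x) → sum f ≤ sum g
  sum-mono-≤ {zero}  f≤g = z≤n
  sum-mono-≤ {suc n} f≤g = ℕ.+-mono-≤ (f≤g Fin.zero) (sum-mono-≤ (f≤g ∘ Fin.suc))

  sum-mono-< : ∀ {n} {f g : Fin n → ℕ} → (∀ x → f x ≤ g x) → ∀ p → f p < g p → sum f < sum g
  sum-mono-< {suc n} f≤g Fin.zero    fp<gp = ℕ.+-mono-<-≤ fp<gp (sum-mono-≤ (f≤g ∘ Fin.suc))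
  sum-mono-< {suc n} f≤g (Fin.suc p) fp<gp = ℕ.+-mono-≤-< (f≤g Fin.zero) (sum-mono-< (f≤g ∘ Fin.suc) p fp<gp)

  mismatch : Bool → Bool → ℕ
  mismatch true  false = 1
  mismatch false true  = 1
  mismatch _     _     = 0

  mismatch-self : ∀ a → mismatch a a ≡ 0
  mismatch-self true  = refl
  mismatch-self false = refl

  mismatch-≤1 : ∀ a b → mismatch a b ≤ 1
  mismatch-≤1 true  true  = z≤n
  mismatch-≤1 true  false = ℕ.≤-refl
  mismatch-≤1 false true  = ℕ.≤-refl
  mismatch-≤1 false false = z≤n

  mismatch-triangle : ∀ a b c → mismatch a c ≤ mismatch a b + mismatch b c
  mismatch-triangle true  true  c     = ℕ.≤-refl
  mismatch-triangle false false c     = ℕ.≤-refl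
  mismatch-triangle true  false true  = z≤n
  mismatch-triangle true  false false = s≤s z≤n
  mismatch-triangle false true  true  = s≤s z≤n
  mismatch-triangle false true  false = z≤n

  mismatch-triangle-strict : ∀ a b c → a ≡ c → a ≢ b → mismatch a c < mismatch a b + mismatch b c
  mismatch-triangle-strict true  true  _ _    a≢b = contradiction refl a≢b
  mismatch-triangle-strict true  false _ refl _   = s≤s z≤n
  mismatch-triangle-strict false true  _ refl _   = s≤s z≤n
  mismatch-triangle-strict false false _ _    a≢b = contradiction refl a≢b

  module _ {n : ℕ} where

    sum₂ : (Fin n → Fin n → ℕ) → ℕ
    sum₂ f = sum λ x → sum λ y → f x y

    sum₂-distrib-+ : ∀ f g → sum₂ (λ x y → f x y + g x y) ≡ sum₂ f + sum₂ g
    sum₂-distrib-+ f g = begin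
      sum (λ x → sum λ y → f x y + g x y)  ≡⟨ sum-cong-≗ (λ x → ∑-distrib-+ (f x) (g x)) ⟩
      sum (λ x → sum (f x) + sum (g x))    ≡⟨ ∑-distrib-+ (λ x → sum (f x)) (λ x → sum (g x)) ⟩
      sum₂ f + sum₂ g                      ∎
      where open ≡-Reasoning

    sum₂-mono-< : ∀ {f g : Fin n → Fin n → ℕ} → (∀ x y → f x y ≤ g x y) →
                  ∀ x y → f x y < g x y → sum₂ f < sum₂ g
    sum₂-mono-< f≤g x y fxy<gxy = sum-mono-< (λ x → sum-mono-≤ (f≤g x)) x (sum-mono-< (f≤g x) y fxy<gxy)

    sum₂-single : ∀ (f : Fin n → Fin n → ℕ) x₀ y₀ → (∀ x y → ¬ (x ≡ x₀ × y ≡ y₀) → f x y ≡ 0) →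
                  sum₂ f ≡ f x₀ y₀
    sum₂-single f x₀ y₀ vanishes = begin
      sum₂ f      ≡⟨ sum-single _ x₀ (λ x x≢x₀ → sum-zero _ (λ y → vanishes x y (x≢x₀ ∘ proj₁))) ⟩
      sum (f x₀)  ≡⟨ sum-single _ y₀ (λ y y≢y₀ → vanishes x₀ y (y≢y₀ ∘ proj₂)) ⟩
      f x₀ y₀     ∎
      where open ≡-Reasoning

    inverted : Permutation′ n → Fin n → Fin n → Bool
    inverted σ x y = (toℕ x <ᵇ toℕ y) ∧ (toℕ (σ ⟨$⟩ʳ y) <ᵇ toℕ (σ ⟨$⟩ʳ x))

    inverted-true : ∀ σ {x y} → toℕ x < toℕ y → toℕ (σ ⟨$⟩ʳ y) < toℕ (σ ⟨$⟩ʳ x) → inverted σ x y ≡ true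
    inverted-true σ x<y σy<σx = cong₂ _∧_ (<ᵇ-true x<y) (<ᵇ-true σy<σx)

    inverted-false : ∀ σ {x y} → ¬ toℕ (σ ⟨$⟩ʳ y) < toℕ (σ ⟨$⟩ʳ x) → inverted σ x y ≡ false
    inverted-false σ {x} {y} σy≮σx = trans (cong ((toℕ x <ᵇ toℕ y) ∧_) (<ᵇ-false σy≮σx)) (∧-zeroʳ _)

    inverted-≮ : ∀ σ {x y} → ¬ toℕ x < toℕ y → inverted σ x y ≡ false
    inverted-≮ σ {x} {y} x≮y = cong (_∧ (toℕ (σ ⟨$⟩ʳ y) <ᵇ toℕ (σ ⟨$⟩ʳ x))) (<ᵇ-false x≮y)

    inverted-id : ∀ x y → inverted id x y ≡ false
    inverted-id x y with toℕ x ℕ.<? toℕ y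
    ... | yes x<y = inverted-false id (ℕ.<-asym x<y)
    ... | no  x≮y = inverted-≮ id x≮y

    invDist : Permutation′ n → Permutation′ n → ℕ
    invDist σ τ = sum₂ λ x y → mismatch (inverted σ x y) (inverted τ x y)

    invCount : Permutation′ n → ℕ
    invCount = invDist id

    invDist-self : ∀ σ → invDist σ σ ≡ 0
    invDist-self σ = sum-zero _ λ x → sum-zero _ λ y → mismatch-self (inverted σ x y)

    invDist-congʳ : ∀ σ {τ τ′ : Permutation′ n} → (∀ k → τ ⟨$⟩ʳ k ≡ τ′ ⟨$⟩ʳ k) → invDist σ τ ≡ invDist σ τ′
    invDist-congʳ σ τ≗τ′ = sum-cong-≗ λ x → sum-cong-≗ λ y →
      cong (λ b → mismatch (inverted σ x y) ((toℕ x <ᵇ toℕ y) ∧ b))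
           (cong₂ (λ u v → toℕ u <ᵇ toℕ v) (τ≗τ′ y) (τ≗τ′ x))

    invDist-triangle : ∀ σ τ ρ → invDist σ ρ ≤ invDist σ τ + invDist τ ρ
    invDist-triangle σ τ ρ = ℕ.≤-trans
      (sum-mono-≤ λ x → sum-mono-≤ λ y → mismatch-triangle (inverted σ x y) (inverted τ x y) (inverted ρ x y))
      (ℕ.≤-reflexive (sum₂-distrib-+ _ _))

    invDist-triangle-strict : ∀ σ τ ρ x y → inverted σ x y ≡ inverted ρ x y → inverted σ x y ≢ inverted τ x y →
                              invDist σ ρ < invDist σ τ + invDist τ ρ
    invDist-triangle-strict σ τ ρ x y σ≡ρ σ≢τ = ℕ.<-≤-trans
      (sum₂-mono-< (λ x y → mismatch-triangle (inverted σ x y) (inverted τ x y) (inverted ρ x y)) x y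
        (mismatch-triangle-strict (inverted σ x y) (inverted τ x y) (inverted ρ x y) σ≡ρ σ≢τ))
      (ℕ.≤-reflexive (sum₂-distrib-+ _ _))

    orderPair : ∀ (p q : Fin n) → Σ (Fin n) λ lo → Σ (Fin n) λ hi →
                ∀ {x y} → toℕ x < toℕ y → (x ≡ p × y ≡ q) ⊎ (x ≡ q × y ≡ p) → x ≡ lo × y ≡ hi
    orderPair p q with toℕ p ℕ.<? toℕ q
    ... | yes p<q = p , q , λ where
          _   (inj₁ x,y≡p,q)       → x,y≡p,q
          x<y (inj₂ (refl , refl)) → contradiction x<y (ℕ.<-asym p<q)
    ... | no p≮q = q , p , λ where
          x<y (inj₁ (refl , refl)) → contradiction x<y p≮q
          _   (inj₂ x,y≡q,p)       → x,y≡q,p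

    Stabilises : ℕ → Permutation′ n → Set
    Stabilises I σ = ∀ k → toℕ k < I ⇔ toℕ (σ ⟨$⟩ʳ k) < I

    ∘ₚ-stabilises : ∀ {I} {σ τ : Permutation′ n} → Stabilises I σ → Stabilises I τ → Stabilises I (σ ∘ₚ τ)
    ∘ₚ-stabilises {σ = σ} σ-stab τ-stab k = τ-stab (σ ⟨$⟩ʳ k) ⇔-∘ σ-stab k

    stabilises-cong : ∀ {I} {σ τ : Permutation′ n} → (∀ k → σ ⟨$⟩ʳ k ≡ τ ⟨$⟩ʳ k) →
                      Stabilises I σ → Stabilises I τ
    stabilises-cong {I} σ≗τ σ-stab k = subst (λ a → toℕ k < I ⇔ toℕ a < I) (σ≗τ k) (σ-stab k)

    stabilises⇒¬inverted : ∀ {I} σ {x y} → Stabilises I σ → toℕ x < I → I ≤ toℕ y → inverted σ x y ≡ false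
    stabilises⇒¬inverted {I} σ {x} {y} σ-stab x<I I≤y = inverted-false σ λ σy<σx →
      ℕ.<⇒≱ (Equivalence.from (σ-stab y) (ℕ.<-trans σy<σx (Equivalence.to (σ-stab x) x<I))) I≤y

    prefix-pigeonhole : ∀ (σ : Permutation′ n) {A B} → A ≤ n → (∀ t → toℕ t < A → toℕ (σ ⟨$⟩ʳ t) < B) → A ≤ B
    prefix-pigeonhole σ {A} {B} A≤n maps = injective⇒≤ {f = f} f-injective
      where
      embed : Fin A → Fin n
      embed t = inject≤ t A≤n
      f : Fin A → Fin B
      f t = fromℕ< (maps (embed t) (subst (_< A) (sym (toℕ-inject≤ t A≤n)) (toℕ<n t)))
      f-injective : ∀ {a b} → f a ≡ f b → a ≡ b
      f-injective {a} {b} fa≡fb = toℕ-injective (begin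
        toℕ a                          ≡⟨ toℕ-inject≤ a A≤n ⟨
        toℕ (embed a)                  ≡⟨ cong toℕ (inverseˡ σ) ⟨
        toℕ (σ ⟨$⟩ˡ (σ ⟨$⟩ʳ embed a))  ≡⟨ cong (λ x → toℕ (σ ⟨$⟩ˡ x)) σa≡σb ⟩
        toℕ (σ ⟨$⟩ˡ (σ ⟨$⟩ʳ embed b))  ≡⟨ cong toℕ (inverseˡ σ) ⟩
        toℕ (embed b)                  ≡⟨ toℕ-inject≤ b A≤n ⟩
        toℕ b                          ∎)
        where
        open ≡-Reasoning
        σa≡σb : σ ⟨$⟩ʳ embed a ≡ σ ⟨$⟩ʳ embed b
        σa≡σb = toℕ-injective (trans (sym (toℕ-fromℕ< _)) (trans (cong toℕ fa≡fb) (toℕ-fromℕ< _)))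

    -- If σ k < I for some k ≥ I, then σ ∘ (I k) maps {0,…,I} into {0,…,I-1}.
    mapsBelow⇒stabilises : ∀ (σ : Permutation′ n) {I} → (∀ k → toℕ k < I → toℕ (σ ⟨$⟩ʳ k) < I) →
                           Stabilises I σ
    mapsBelow⇒stabilises σ {I} maps k = mk⇔ (maps k) reflects
      where
      reflects : toℕ (σ ⟨$⟩ʳ k) < I → toℕ k < I
      reflects σk<I with toℕ k ℕ.<? I
      ... | yes k<I = k<I
      ... | no k≮I = contradiction (prefix-pigeonhole (transpose I′ k ∘ₚ σ) I<n swapped) ℕ.1+n≰n
        where
        I<n : I < n
        I<n = ℕ.≤-<-trans (ℕ.≮⇒≥ k≮I) (toℕ<n k)
        I′ : Fin n
        I′ = fromℕ< I<n
        swapped : ∀ t → toℕ t < suc I → toℕ (σ ⟨$⟩ʳ PC.transpose I′ k t) < I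
        swapped t t≤I with t ≟ I′
        ... | yes refl = σk<I
        ... | no t≢I′ with t ≟ k | ℕ.≤∧≢⇒< (s≤s⁻¹ t≤I) (λ t≡I → t≢I′ (toℕ-injective (trans t≡I (sym (toℕ-fromℕ< I<n)))))
        ...   | yes refl | t<I = contradiction t<I k≮I
        ...   | no _     | t<I = maps t t<I

    opposite-< : ∀ {x y : Fin n} → toℕ x < toℕ y → toℕ (opposite y) < toℕ (opposite x)
    opposite-< {x} {y} x<y = subst₂ _<_ (sym (opposite-prop y)) (sym (opposite-prop x))
      (ℕ.∸-monoʳ-< (s≤s x<y) (toℕ<n y))

    ExchangesBlocks : ℕ → Permutation′ n → Set
    ExchangesBlocks I w = ∀ r s → toℕ r < I → I ≤ toℕ s → toℕ (w ⟨$⟩ˡ s) < toℕ (w ⟨$⟩ˡ r)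

    stabilises⇒exchangesBlocks : ∀ {I} w → Stabilises I (reverse ∘ₚ w) → ExchangesBlocks I w
    stabilises⇒exchangesBlocks {I} w π-stab r s r<I I≤s =
      subst₂ (λ a b → toℕ a < toℕ b) (opposite-involutive _) (opposite-involutive _) (opposite-< π⁻¹r<π⁻¹s)
      where
      π : Permutation′ n
      π = reverse ∘ₚ w
      π⁻¹r<I : toℕ (π ⟨$⟩ˡ r) < I
      π⁻¹r<I = Equivalence.from (π-stab _) (subst (λ a → toℕ a < I) (sym (inverseʳ π)) r<I)
      I≤π⁻¹s : I ≤ toℕ (π ⟨$⟩ˡ s)
      I≤π⁻¹s = ℕ.≮⇒≥ λ π⁻¹s<I →
        ℕ.<⇒≱ (subst (λ a → toℕ a < I) (inverseʳ π) (Equivalence.to (π-stab _) π⁻¹s<I)) I≤s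
      π⁻¹r<π⁻¹s : toℕ (π ⟨$⟩ˡ r) < toℕ (π ⟨$⟩ˡ s)
      π⁻¹r<π⁻¹s = ℕ.<-≤-trans π⁻¹r<I I≤π⁻¹s

    -- If π k ≥ I for some k < I, then π⁻¹ maps {0,…,I-1} into {0,…,k-1}.
    exchangesBlocks⇒stabilises : ∀ {I} w → ExchangesBlocks I w → Stabilises I (reverse ∘ₚ w)
    exchangesBlocks⇒stabilises {I} w exchanges = mapsBelow⇒stabilises π mapsBelow
      where
      π : Permutation′ n
      π = reverse ∘ₚ w
      mapsBelow : ∀ k → toℕ k < I → toℕ (π ⟨$⟩ʳ k) < I
      mapsBelow k k<I with toℕ (π ⟨$⟩ʳ k) ℕ.<? I
      ... | yes πk<I = πk<I
      ... | no πk≮I  = contradiction (prefix-pigeonhole (flip π) I≤n below-k) (ℕ.<⇒≱ k<I)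
        where
        I≤πk : I ≤ toℕ (π ⟨$⟩ʳ k)
        I≤πk = ℕ.≮⇒≥ πk≮I
        I≤n : I ≤ n
        I≤n = ℕ.<⇒≤ (ℕ.≤-<-trans I≤πk (toℕ<n _))
        below-k : ∀ r → toℕ r < I → toℕ (π ⟨$⟩ˡ r) < toℕ k
        below-k r r<I = subst (λ a → toℕ (opposite (w ⟨$⟩ˡ r)) < toℕ a) (opposite-involutive k)
          (opposite-< (subst (λ a → toℕ a < toℕ (w ⟨$⟩ˡ r)) (inverseˡ w) (exchanges r (π ⟨$⟩ʳ k) r<I I≤πk)))

    exchangesBlocks⇔stabilises : ∀ {I} w → ExchangesBlocks I w ⇔ Stabilises I (reverse ∘ₚ w)
    exchangesBlocks⇔stabilises w = mk⇔ (exchangesBlocks⇒stabilises w) (stabilises⇒exchangesBlocks w)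

  module _ {m : ℕ} where

    data SimpleReflView (j : Fin m) (a : Fin (suc m)) : Fin (suc m) → Set where
      at-j   : a ≡ inject₁ j → SimpleReflView j a (Fin.suc j)
      at-suc : a ≡ Fin.suc j → SimpleReflView j a (inject₁ j)
      away   : a ≢ inject₁ j → a ≢ Fin.suc j → SimpleReflView j a a

    simpleReflView : ∀ j a → SimpleReflView j a (simpleRefl j ⟨$⟩ʳ a)
    simpleReflView j a with a ≟ inject₁ j
    ... | yes a≡j = at-j a≡j
    ... | no a≢j with a ≟ Fin.suc j
    ...   | yes a≡1+j = at-suc a≡1+j
    ...   | no a≢1+j  = away a≢j a≢1+j

    inject₁<suc : ∀ (j : Fin m) → toℕ (inject₁ j) < toℕ (Fin.suc j)
    inject₁<suc j = ≤̄⇒inject₁< ℕ.≤-refl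

    inject₁≢suc : ∀ (j : Fin m) → inject₁ j ≢ Fin.suc j
    inject₁≢suc j = ℕ.<⇒≢ (inject₁<suc j) ∘ cong toℕ

    simpleRefl-inject₁ : ∀ j → simpleRefl j ⟨$⟩ʳ inject₁ j ≡ Fin.suc j
    simpleRefl-inject₁ j with simpleRefl j ⟨$⟩ʳ inject₁ j | simpleReflView j (inject₁ j)
    ... | _ | at-j _    = refl
    ... | _ | at-suc e  = contradiction e (inject₁≢suc j)
    ... | _ | away ne _ = contradiction refl ne

    simpleRefl-suc : ∀ j → simpleRefl j ⟨$⟩ʳ Fin.suc j ≡ inject₁ j
    simpleRefl-suc j with simpleRefl j ⟨$⟩ʳ Fin.suc j | simpleReflView j (Fin.suc j)
    ... | _ | at-j e    = contradiction (sym e) (inject₁≢suc j)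
    ... | _ | at-suc _  = refl
    ... | _ | away _ ne = contradiction refl ne

    simpleRefl-involutive : ∀ j a → simpleRefl j ⟨$⟩ʳ (simpleRefl j ⟨$⟩ʳ a) ≡ a
    simpleRefl-involutive j a with simpleRefl j ⟨$⟩ʳ a | simpleReflView j a
    ... | _ | at-j refl   = simpleRefl-suc j
    ... | _ | at-suc refl = simpleRefl-inject₁ j
    ... | _ | away ne ne′ with simpleRefl j ⟨$⟩ʳ a | simpleReflView j a
    ...   | _ | at-j e   = contradiction e ne
    ...   | _ | at-suc e = contradiction e ne′
    ...   | _ | away _ _ = refl

    ∘ₚ-simpleRefl-inject₁ : ∀ (σ : Permutation′ (suc m)) j → (σ ∘ₚ simpleRefl j) ⟨$⟩ʳ (σ ⟨$⟩ˡ inject₁ j) ≡ Fin.suc j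
    ∘ₚ-simpleRefl-inject₁ σ j = trans (cong (simpleRefl j ⟨$⟩ʳ_) (inverseʳ σ {inject₁ j})) (simpleRefl-inject₁ j)

    ∘ₚ-simpleRefl-suc : ∀ (σ : Permutation′ (suc m)) j → (σ ∘ₚ simpleRefl j) ⟨$⟩ʳ (σ ⟨$⟩ˡ Fin.suc j) ≡ inject₁ j
    ∘ₚ-simpleRefl-suc σ j = trans (cong (simpleRefl j ⟨$⟩ʳ_) (inverseʳ σ {Fin.suc j})) (simpleRefl-suc j)

    ∘ₚ-simpleRefl-inverts : ∀ (σ : Permutation′ (suc m)) j → toℕ (σ ⟨$⟩ˡ inject₁ j) < toℕ (σ ⟨$⟩ˡ Fin.suc j) →
                            inverted (σ ∘ₚ simpleRefl j) (σ ⟨$⟩ˡ inject₁ j) (σ ⟨$⟩ˡ Fin.suc j) ≡ true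
    ∘ₚ-simpleRefl-inverts σ j x<y = inverted-true (σ ∘ₚ simpleRefl j) x<y
      (subst₂ (λ a b → toℕ a < toℕ b) (sym (∘ₚ-simpleRefl-suc σ j)) (sym (∘ₚ-simpleRefl-inject₁ σ j)) (inject₁<suc j))

    simpleRefl-<-mono : ∀ j {a b} → toℕ a < toℕ b → ¬ (a ≡ inject₁ j × b ≡ Fin.suc j) →
                        toℕ (simpleRefl j ⟨$⟩ʳ a) < toℕ (simpleRefl j ⟨$⟩ʳ b)
    simpleRefl-<-mono j {a} {b} a<b ¬adjacent
      with simpleRefl j ⟨$⟩ʳ a | simpleReflView j a | simpleRefl j ⟨$⟩ʳ b | simpleReflView j b
    ... | _ | at-j refl   | _ | at-j refl     = contradiction a<b (ℕ.<-irrefl refl)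
    ... | _ | at-j refl   | _ | at-suc refl   = contradiction (refl , refl) ¬adjacent
    ... | _ | at-j refl   | _ | away _ b≢1+j  =
      ℕ.≤∧≢⇒< (subst (_< toℕ b) (toℕ-inject₁ j) a<b) (b≢1+j ∘ toℕ-injective ∘ sym)
    ... | _ | at-suc refl | _ | at-j refl     = contradiction (ℕ.<-trans a<b (inject₁<suc j)) (ℕ.<-irrefl refl)
    ... | _ | at-suc refl | _ | at-suc refl   = contradiction a<b (ℕ.<-irrefl refl)
    ... | _ | at-suc refl | _ | away _ _      = ℕ.<-trans (inject₁<suc j) a<b
    ... | _ | away _ _    | _ | at-j refl     = ℕ.<-trans a<b (inject₁<suc j)
    ... | _ | away a≢j _  | _ | at-suc refl   = subst (toℕ a <_) (sym (toℕ-inject₁ j))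
      (ℕ.≤∧≢⇒< (s≤s⁻¹ a<b) (a≢j ∘ toℕ-injective ∘ (λ e → trans e (sym (toℕ-inject₁ j)))))
    ... | _ | away _ _    | _ | away _ _      = a<b

    simpleRefl-<-suc : ∀ {j i : Fin m} {a} → j ≢ i → toℕ a < suc (toℕ i) →
                       toℕ (simpleRefl j ⟨$⟩ʳ a) < suc (toℕ i)
    simpleRefl-<-suc {j} {i} {a} j≢i a≤i with simpleRefl j ⟨$⟩ʳ a | simpleReflView j a
    ... | _ | at-j refl   = s≤s (ℕ.≤∧≢⇒< (subst (_≤ toℕ i) (toℕ-inject₁ j) (s≤s⁻¹ a≤i)) (j≢i ∘ toℕ-injective))
    ... | _ | at-suc refl = ℕ.<-trans (inject₁<suc j) a≤i
    ... | _ | away _ _    = a≤i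

    simpleRefl-stabilises : ∀ {i j : Fin m} → j ≢ i → Stabilises (suc (toℕ i)) (simpleRefl j)
    simpleRefl-stabilises {i} {j} j≢i k = mk⇔ (simpleRefl-<-suc j≢i) λ sk≤i →
      subst (λ a → toℕ a < suc (toℕ i)) (simpleRefl-involutive j k) (simpleRefl-<-suc j≢i sk≤i)

    inverted-simpleRefl : ∀ (σ : Permutation′ (suc m)) j {x y} → toℕ x < toℕ y →
                          ¬ (x ≡ σ ⟨$⟩ˡ inject₁ j × y ≡ σ ⟨$⟩ˡ Fin.suc j) →
                          ¬ (x ≡ σ ⟨$⟩ˡ Fin.suc j × y ≡ σ ⟨$⟩ˡ inject₁ j) →
                          inverted (σ ∘ₚ simpleRefl j) x y ≡ inverted σ x y
    inverted-simpleRefl σ j {x} {y} x<y ¬xy ¬yx = cong ((toℕ x <ᵇ toℕ y) ∧_) values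
      where
      at : ∀ {z a} → σ ⟨$⟩ʳ z ≡ a → z ≡ σ ⟨$⟩ˡ a
      at e = trans (sym (inverseˡ σ)) (cong (σ ⟨$⟩ˡ_) e)
      values : (toℕ (simpleRefl j ⟨$⟩ʳ (σ ⟨$⟩ʳ y)) <ᵇ toℕ (simpleRefl j ⟨$⟩ʳ (σ ⟨$⟩ʳ x)))
             ≡ (toℕ (σ ⟨$⟩ʳ y) <ᵇ toℕ (σ ⟨$⟩ʳ x))
      values with ℕ.<-cmp (toℕ (σ ⟨$⟩ʳ y)) (toℕ (σ ⟨$⟩ʳ x))
      ... | tri< σy<σx _ _ = trans (<ᵇ-true (simpleRefl-<-mono j σy<σx λ (e₁ , e₂) → ¬yx (at e₂ , at e₁)))
                                   (sym (<ᵇ-true σy<σx))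
      ... | tri≈ _ σy≡σx _ = contradiction (trans (at (toℕ-injective (sym σy≡σx))) (inverseˡ σ))
                                           (ℕ.<⇒≢ x<y ∘ cong toℕ)
      ... | tri> _ _ σx<σy = trans (<ᵇ-false (ℕ.<-asym (simpleRefl-<-mono j σx<σy λ (e₁ , e₂) → ¬xy (at e₁ , at e₂))))
                                   (sym (<ᵇ-false (ℕ.<-asym σx<σy)))

    invDist-simpleRefl : ∀ (σ : Permutation′ (suc m)) j → invDist σ (σ ∘ₚ simpleRefl j) ≤ 1
    invDist-simpleRefl σ j with orderPair (σ ⟨$⟩ˡ inject₁ j) (σ ⟨$⟩ˡ Fin.suc j)
    ... | lo , hi , ordered = ℕ.≤-trans (ℕ.≤-reflexive (sum₂-single _ lo hi unchanged)) (mismatch-≤1 _ _)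
      where
      unchanged : ∀ (x y : Fin (suc m)) → ¬ (x ≡ lo × y ≡ hi) →
                  mismatch (inverted σ x y) (inverted (σ ∘ₚ simpleRefl j) x y) ≡ 0
      unchanged x y ¬lo,hi with toℕ x ℕ.<? toℕ y
      ... | no x≮y  = cong₂ mismatch (inverted-≮ σ x≮y) (inverted-≮ (σ ∘ₚ simpleRefl j) x≮y)
      ... | yes x<y = trans (cong (mismatch (inverted σ x y))
          (inverted-simpleRefl σ j x<y (¬lo,hi ∘ ordered x<y ∘ inj₁) (¬lo,hi ∘ ordered x<y ∘ inj₂)))
        (mismatch-self (inverted σ x y))

    invCount-descent : ∀ (σ : Permutation′ (suc m)) j → toℕ (σ ⟨$⟩ˡ Fin.suc j) < toℕ (σ ⟨$⟩ˡ inject₁ j) →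
                       invCount (σ ∘ₚ simpleRefl j) < invCount σ
    invCount-descent σ j p′<p = sum₂-mono-< fewer p′ p strictly
      where
      p p′ : Fin (suc m)
      p = σ ⟨$⟩ˡ inject₁ j
      p′ = σ ⟨$⟩ˡ Fin.suc j
      τ : Permutation′ (suc m)
      τ = σ ∘ₚ simpleRefl j
      removed : inverted τ p′ p ≡ false
      removed = inverted-false τ (subst₂ (λ a b → ¬ toℕ a < toℕ b)
        (sym (∘ₚ-simpleRefl-inject₁ σ j)) (sym (∘ₚ-simpleRefl-suc σ j)) (ℕ.<-asym (inject₁<suc j)))
      present : inverted σ p′ p ≡ true
      present = inverted-true σ p′<p
        (subst₂ (λ a b → toℕ a < toℕ b) (sym (inverseʳ σ)) (sym (inverseʳ σ)) (inject₁<suc j))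
      strictly : mismatch (inverted id p′ p) (inverted τ p′ p) < mismatch (inverted id p′ p) (inverted σ p′ p)
      strictly rewrite inverted-id p′ p | removed | present = s≤s z≤n
      fewer : ∀ x y → mismatch (inverted id x y) (inverted τ x y) ≤ mismatch (inverted id x y) (inverted σ x y)
      fewer x y with toℕ x ℕ.<? toℕ y
      ... | no x≮y rewrite inverted-≮ τ x≮y | inverted-≮ σ x≮y = ℕ.≤-refl
      ... | yes x<y with x ≟ p′ | y ≟ p
      ...   | yes refl | yes refl rewrite inverted-id p′ p | removed = z≤n
      ...   | no x≢p′  | _        = ℕ.≤-reflexive (cong (mismatch (inverted id x y))
              (inverted-simpleRefl σ j x<y (λ { (refl , refl) → ℕ.<-asym x<y p′<p }) (x≢p′ ∘ proj₁)))
      ...   | yes _    | no y≢p   = ℕ.≤-reflexive (cong (mismatch (inverted id x y))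
              (inverted-simpleRefl σ j x<y (λ { (refl , refl) → ℕ.<-asym x<y p′<p }) (y≢p ∘ proj₂)))

    word : List (Fin m) → Permutation′ (suc m)
    word []       = id
    word (j ∷ js) = word js ∘ₚ simpleRefl j

    Expresses : List (Fin m) → Permutation′ (suc m) → Set
    Expresses ws σ = ∀ k → evalWord ws k ≡ σ ⟨$⟩ʳ k

    word-expresses : ∀ ws → Expresses ws (word ws)
    word-expresses []       k = refl
    word-expresses (j ∷ js) k = cong (simpleRefl j ⟨$⟩ʳ_) (word-expresses js k)

    word-++ : ∀ u v k → evalWord (u ++ v) k ≡ (word v ∘ₚ word u) ⟨$⟩ʳ k
    word-++ []      v k = word-expresses v k
    word-++ (j ∷ u) v k = cong (simpleRefl j ⟨$⟩ʳ_) (word-++ u v k)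

    word-stabilises : ∀ {i} ws → i ∉ ws → Stabilises (suc (toℕ i)) (word ws)
    word-stabilises []       _    k = mk⇔ (λ k≤i → k≤i) (λ k≤i → k≤i)
    word-stabilises (j ∷ ws) i∉ws = ∘ₚ-stabilises {σ = word ws} {τ = simpleRefl j}
      (word-stabilises ws (i∉ws ∘ there)) (simpleRefl-stabilises (λ j≡i → i∉ws (here (sym j≡i))))

    invDist-word : ∀ (σ : Permutation′ (suc m)) u → invDist σ (σ ∘ₚ word u) ≤ length u
    invDist-word σ []      = ℕ.≤-reflexive (invDist-self σ)
    invDist-word σ (j ∷ u) = begin
      invDist σ ρ                   ≤⟨ invDist-triangle σ τ ρ ⟩
      invDist σ τ + invDist τ ρ     ≤⟨ ℕ.+-mono-≤ (invDist-word σ u) (invDist-simpleRefl τ j) ⟩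
      length u + 1                  ≡⟨ ℕ.+-comm (length u) 1 ⟩
      length (j ∷ u)                ∎
      where
      open ℕ.≤-Reasoning
      τ ρ : Permutation′ (suc m)
      τ = σ ∘ₚ word u
      ρ = σ ∘ₚ word (j ∷ u)

    invCount-≤-length : ∀ π vs → Expresses vs π → invCount π ≤ length vs
    invCount-≤-length π vs vs↦π = begin
      invCount π          ≡⟨ invDist-congʳ id {π} {word vs} (λ k → trans (sym (vs↦π k)) (word-expresses vs k)) ⟩
      invCount (word vs)  ≤⟨ invDist-word id vs ⟩
      length vs           ∎
      where open ℕ.≤-Reasoning

    ascending⇒id : ∀ (f : Fin (suc m) → Fin (suc m)) → (∀ j → toℕ (f (inject₁ j)) < toℕ (f (Fin.suc j))) →
                   ∀ k → f k ≡ k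
    ascending⇒id f ascending k = toℕ-injective (ℕ.≤-antisym (below k) (above k))
      where
      above : ∀ k → toℕ k ≤ toℕ (f k)
      above = <-weakInduction (λ k → toℕ k ≤ toℕ (f k)) z≤n λ j k≤fk →
        ℕ.≤-trans (s≤s (subst (_≤ toℕ (f (inject₁ j))) (toℕ-inject₁ j) k≤fk)) (ascending j)
      below : ∀ k → toℕ (f k) ≤ toℕ k
      below = >-weakInduction (λ k → toℕ (f k) ≤ toℕ k)
        (subst (toℕ (f (fromℕ m)) ≤_) (sym (toℕ-fromℕ m)) (toℕ≤pred[n] (f (fromℕ m)))) λ j fk≤k →
        subst (toℕ (f (inject₁ j)) ≤_) (sym (toℕ-inject₁ j)) (s≤s⁻¹ (ℕ.<-≤-trans (ascending j) fk≤k))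

    sortingWord : ∀ N (σ : Permutation′ (suc m)) → invCount σ ≤ N →
                  Σ (List (Fin m)) λ ws → Expresses ws σ × length ws ≤ invCount σ
    sortingWord N σ bound with any? (λ j → toℕ (σ ⟨$⟩ˡ Fin.suc j) ℕ.<? toℕ (σ ⟨$⟩ˡ inject₁ j))
    ... | no noDescent = [] , (λ k → sym (σ≗id k)) , z≤n
      where
      ascending : ∀ j → toℕ (σ ⟨$⟩ˡ inject₁ j) < toℕ (σ ⟨$⟩ˡ Fin.suc j)
      ascending j = ℕ.≤∧≢⇒< (ℕ.≮⇒≥ (noDescent ∘ (j ,_)))
        (λ e → inject₁≢suc j (trans (sym (inverseʳ σ)) (trans (cong (σ ⟨$⟩ʳ_) (toℕ-injective e)) (inverseʳ σ))))
      σ≗id : ∀ k → σ ⟨$⟩ʳ k ≡ k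
      σ≗id k = trans (sym (ascending⇒id (σ ⟨$⟩ˡ_) ascending (σ ⟨$⟩ʳ k))) (inverseˡ σ)
    sortingWord zero    σ bound | yes (j , descent) =
      contradiction (ℕ.<-≤-trans (invCount-descent σ j descent) bound) ℕ.n≮0
    sortingWord (suc N) σ bound | yes (j , descent)
      with sortingWord N (σ ∘ₚ simpleRefl j) (s≤s⁻¹ (ℕ.<-≤-trans (invCount-descent σ j descent) bound))
    ... | ws , ws↦τ , length≤ = j ∷ ws ,
      (λ k → trans (cong (simpleRefl j ⟨$⟩ʳ_) (ws↦τ k)) (simpleRefl-involutive j (σ ⟨$⟩ʳ k))) ,
      ℕ.≤-trans (s≤s length≤) (invCount-descent σ j descent)

    reducedExpression-exists : ∀ π → Σ (List (Fin m)) λ ws → IsReducedExpression ws (π ⟨$⟩ʳ_)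
    reducedExpression-exists π with sortingWord (invCount π) π ℕ.≤-refl
    ... | ws , ws↦π , length≤ = ws , ws↦π , λ vs vs↦π → ℕ.≤-trans length≤ (invCount-≤-length π vs vs↦π)

    reduced⇒length≤invCount : ∀ π {ws} → IsReducedExpression ws (π ⟨$⟩ʳ_) → length ws ≤ invCount π
    reduced⇒length≤invCount π (_ , minimal) with sortingWord (invCount π) π ℕ.≤-refl
    ... | vs , vs↦π , length≤ = ℕ.≤-trans (minimal vs vs↦π) length≤

    lastOccurrence : ∀ {i : Fin m} {ws} → i ∈ ws →
                     Σ (List (Fin m)) λ u → Σ (List (Fin m)) λ v → ws ≡ u ++ i ∷ v × i ∉ v
    lastOccurrence {i} {j ∷ ws} i∈ with Any.any? (i ≟_) ws
    ... | yes i∈ws with lastOccurrence i∈ws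
    ...   | u , v , refl , i∉v = j ∷ u , v , refl , i∉v
    lastOccurrence {i} {j ∷ ws} (here refl)  | no i∉ws = [] , ws , refl , i∉ws
    lastOccurrence {i} {j ∷ ws} (there i∈ws) | no i∉ws = contradiction i∈ws i∉ws

    stabilises⇒straddles : ∀ {i} {σ : Permutation′ (suc m)} → Stabilises (suc (toℕ i)) σ →
      toℕ (σ ⟨$⟩ˡ inject₁ i) < suc (toℕ i) × suc (toℕ i) ≤ toℕ (σ ⟨$⟩ˡ Fin.suc i)
    stabilises⇒straddles {i} {σ} σ-stab =
      Equivalence.from (σ-stab _) (subst (λ a → toℕ a < I) (sym (inverseʳ σ)) (inject₁<suc i)) ,
      ℕ.≮⇒≥ λ y<I → ℕ.<-irrefl refl (subst (λ a → toℕ a < I) (inverseʳ σ) (Equivalence.to (σ-stab _) y<I))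
      where I = suc (toℕ i)

    -- Split ws = u ++ i ∷ v at the last i, so that σ = word v stabilises the blocks: the letter i
    -- then inverts the pair σ⁻¹ {i, i+1}, which straddles the blocks and is not inverted by π.
    stabilises∧∈⇒invCount<length : ∀ {i} π ws → Stabilises (suc (toℕ i)) π → Expresses ws π → i ∈ ws →
                                   invCount π < length ws
    stabilises∧∈⇒invCount<length {i} π ws π-stab ws↦π i∈ws with lastOccurrence i∈ws
    ... | u , v , refl , i∉v = begin-strict
      invCount π                                ≡⟨ invDist-congʳ id {π} {ρ} (λ k → sym (ρ≗π k)) ⟩
      invDist id ρ                              <⟨ invDist-triangle-strict id τ ρ x₀ y₀ id≡ρ id≢τ ⟩
      invDist id τ + invDist τ ρ                ≤⟨ ℕ.+-monoˡ-≤ _ (invDist-triangle id σ τ) ⟩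
      invDist id σ + invDist σ τ + invDist τ ρ  ≤⟨ ℕ.+-mono-≤ (ℕ.+-mono-≤ (invDist-word id v) (invDist-simpleRefl σ i))
                                                              (invDist-word τ u) ⟩
      length v + 1 + length u                   ≡⟨ ℕ.+-comm (length v + 1) (length u) ⟩
      length u + (length v + 1)                 ≡⟨ cong (length u +_) (ℕ.+-comm (length v) 1) ⟩
      length u + length (i ∷ v)                 ≡⟨ List.length-++ u ⟨
      length (u ++ i ∷ v)                       ∎
      where
      open ℕ.≤-Reasoning
      σ τ ρ : Permutation′ (suc m)
      σ = word v
      τ = σ ∘ₚ simpleRefl i
      ρ = τ ∘ₚ word u
      x₀ y₀ : Fin (suc m)
      x₀ = σ ⟨$⟩ˡ inject₁ i
      y₀ = σ ⟨$⟩ˡ Fin.suc i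
      ρ≗π : ∀ k → ρ ⟨$⟩ʳ k ≡ π ⟨$⟩ʳ k
      ρ≗π k = trans (sym (word-++ u (i ∷ v) k)) (ws↦π k)
      straddles : toℕ x₀ < suc (toℕ i) × suc (toℕ i) ≤ toℕ y₀
      straddles = stabilises⇒straddles {σ = σ} (word-stabilises v i∉v)
      id≡ρ : inverted id x₀ y₀ ≡ inverted ρ x₀ y₀
      id≡ρ = trans (inverted-id x₀ y₀)
        (sym (stabilises⇒¬inverted ρ (stabilises-cong {σ = π} {τ = ρ} (sym ∘ ρ≗π) π-stab)
                                     (proj₁ straddles) (proj₂ straddles)))
      id≢τ : inverted id x₀ y₀ ≢ inverted τ x₀ y₀
      id≢τ id≡τ = not-¬ (inverted-id x₀ y₀) (trans id≡τ
        (∘ₚ-simpleRefl-inverts σ i (ℕ.<-≤-trans (proj₁ straddles) (proj₂ straddles))))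

    reduced-avoids : ∀ {i} π {ws} → Stabilises (suc (toℕ i)) π → IsReducedExpression ws (π ⟨$⟩ʳ_) → i ∉ ws
    reduced-avoids π {ws} π-stab reduced@(ws↦π , _) i∈ws = ℕ.<-irrefl refl
      (ℕ.≤-<-trans (reduced⇒length≤invCount π {ws} reduced)
                   (stabilises∧∈⇒invCount<length π ws π-stab ws↦π i∈ws))

  module _ {m : ℕ} (π : Permutation′ (suc m)) (i : Fin m) where

    stabilises⇔some-reduced-avoids :
      Stabilises (suc (toℕ i)) π ⇔ Σ (List (Fin m)) λ ws → IsReducedExpression ws (π ⟨$⟩ʳ_) × i ∉ ws
    stabilises⇔some-reduced-avoids = mk⇔
      (λ π-stab → let ws , reduced = reducedExpression-exists π in ws , reduced , reduced-avoids π π-stab reduced)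
      (λ (ws , (ws↦π , _) , i∉ws) → stabilises-cong {σ = word ws} {τ = π}
        (λ k → trans (sym (word-expresses ws k)) (ws↦π k)) (word-stabilises ws i∉ws))

    stabilises⇔every-reduced-avoids :
      Stabilises (suc (toℕ i)) π ⇔ (∀ ws → IsReducedExpression ws (π ⟨$⟩ʳ_) → i ∉ ws)
    stabilises⇔every-reduced-avoids = mk⇔
      (λ π-stab ws → reduced-avoids π π-stab)
      (λ avoid → let ws , reduced = reducedExpression-exists π in
        Equivalence.from stabilises⇔some-reduced-avoids (ws , reduced , avoid ws reduced))

module Matrices {c ℓ} (F : Field c ℓ) where
  open Field F
  open import Data.Nat.Base using (_≤_; _<_; z≤n; s≤s)
  import Data.Nat.Properties as ℕ
  open import Data.Fin.Base using (_>_)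
  open import Data.Fin.Induction using (>-wellFounded; Acc; acc)
  open import Data.Fin.Properties using (_≟_; toℕ-injective; toℕ<n)
  open import Data.Sum using (_⊎_; inj₁; inj₂)
  open import Relation.Binary.Definitions using (tri<; tri≈; tri>)
  open import Relation.Binary.PropositionalEquality as ≡ using (_≡_; _≢_)
  open import Relation.Binary.Reasoning.Setoid setoid
  open import Algebra.Properties.Ring ring
    using (-0#≈0#; -‿+-comm; [y-z]x≈yx-zx; x[y-z]≈xy-xz; x∙y⁻¹≈ε⇒x≈y; x≈y⇒x∙y⁻¹≈ε)
  open import Algebra.Properties.CommutativeSemigroup *-commutativeSemigroup using (x∙yz≈y∙xz)
  open SemiringSum semiring
    using (sum; sum-zero; sum-single; sum-cong-≋; sum-cong-≗; ∑-comm; ∑-distrib-+; sum-permute;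
           *-distribˡ-sum; *-distribʳ-sum)
  open Permutations using (ExchangesBlocks)

  private variable n : ℕ

  infixr 7 _⋆_ _·_
  infix 4 _≋_ _≈ᵥ_

  _⋆_ : Mat F n → Vect F n → Vect F n
  _⋆_ = Defs._⋆_ F

  _·_ : Mat F n → Mat F n → Mat F n
  _·_ = Defs._·_ F

  _≋_ : Mat F n → Mat F n → Set ℓ
  _≋_ = Defs._≋_ F

  _≈ᵥ_ : Vect F n → Vect F n → Set ℓ
  u ≈ᵥ v = ∀ r → u r ≈ v r

  0ᵥ : Vect F n
  0ᵥ _ = 0#

  basis : Fin n → Vect F n
  basis t r = δ F r t

  _⊖_ : Vect F n → Vect F n → Vect F n
  (u ⊖ v) r = u r - v r

  _⊙_ : Carrier → Vect F n → Vect F n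
  (a ⊙ v) r = a * v r

  _⊟_ : Mat F n → Mat F n → Mat F n
  (M ⊟ N) x t = M x t - N x t

  δ-diag : ∀ (r : Fin n) → δ F r r ≈ 1#
  δ-diag r with r ≟ r
  ... | yes _   = refl
  ... | no r≢r  = contradiction ≡.refl r≢r

  δ-off : ∀ {r s : Fin n} → r ≢ s → δ F r s ≈ 0#
  δ-off {r = r} {s} r≢s with r ≟ s
  ... | yes r≡s = contradiction r≡s r≢s
  ... | no _    = refl

  sum-neg : ∀ (f : Fin n → Carrier) → sum (λ t → - f t) ≈ - sum f
  sum-neg {zero}  f = sym -0#≈0#
  sum-neg {suc n} f = trans (+-congˡ (sum-neg (f ∘ Fin.suc))) (-‿+-comm (f Fin.zero) (sum (f ∘ Fin.suc)))

  sum-sub : ∀ (f g : Fin n → Carrier) → sum (λ t → f t - g t) ≈ sum f - sum g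
  sum-sub f g = trans (∑-distrib-+ f (λ t → - g t)) (+-congˡ (sum-neg g))

  ⋆-congʳ : ∀ (M : Mat F n) {u v} → u ≈ᵥ v → M ⋆ u ≈ᵥ M ⋆ v
  ⋆-congʳ M u≈v r = sum-cong-≋ λ t → *-congˡ (u≈v t)

  ⋆-congˡ : ∀ {M N : Mat F n} v → M ≋ N → M ⋆ v ≈ᵥ N ⋆ v
  ⋆-congˡ v M≋N r = sum-cong-≋ λ t → *-congʳ (M≋N r t)

  ·-⋆ : ∀ (A B : Mat F n) v → (A · B) ⋆ v ≈ᵥ A ⋆ (B ⋆ v)
  ·-⋆ A B v r = begin
    sum (λ t → sum (λ u → A r u * B u t) * v t)    ≈⟨ sum-cong-≋ (λ t → *-distribʳ-sum (v t) (λ u → A r u * B u t)) ⟩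
    sum (λ t → sum (λ u → A r u * B u t * v t))    ≈⟨ ∑-comm (λ t u → A r u * B u t * v t) ⟩
    sum (λ u → sum (λ t → A r u * B u t * v t))    ≈⟨ sum-cong-≋ (λ u → sum-cong-≋ (λ t → *-assoc (A r u) (B u t) (v t))) ⟩
    sum (λ u → sum (λ t → A r u * (B u t * v t)))  ≈⟨ sum-cong-≋ (λ u → *-distribˡ-sum (A r u) (λ t → B u t * v t)) ⟨
    sum (λ u → A r u * sum (λ t → B u t * v t))    ∎

  ·-·-⋆ : ∀ (A N B : Mat F n) v → (A · (N · B)) ⋆ v ≈ᵥ A ⋆ (N ⋆ (B ⋆ v))
  ·-·-⋆ A N B v r = trans (·-⋆ A (N · B) v r) (⋆-congʳ A (·-⋆ N B v) r)

  ⋆-basis : ∀ (M : Mat F n) t r → (M ⋆ basis t) r ≈ M r t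
  ⋆-basis M t r = begin
    sum (λ u → M r u * δ F u t)  ≈⟨ sum-single _ t (λ u u≢t → trans (*-congˡ (δ-off u≢t)) (zeroʳ _)) ⟩
    M r t * δ F t t              ≈⟨ *-congˡ (δ-diag t) ⟩
    M r t * 1#                   ≈⟨ *-identityʳ (M r t) ⟩
    M r t                        ∎

  ≋-by-columns : ∀ {M N : Mat F n} → (∀ t → M ⋆ basis t ≈ᵥ N ⋆ basis t) → M ≋ N
  ≋-by-columns {M = M} {N} columns r t = trans (sym (⋆-basis M t r)) (trans (columns t r) (⋆-basis N t r))

  idMat-⋆ : ∀ (v : Vect F n) → idMat F ⋆ v ≈ᵥ v
  idMat-⋆ v r = begin
    sum (λ u → δ F r u * v u)  ≈⟨ sum-single _ r (λ u u≢r → trans (*-congʳ (δ-off (u≢r ∘ ≡.sym))) (zeroˡ _)) ⟩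
    δ F r r * v r              ≈⟨ *-congʳ (δ-diag r) ⟩
    1# * v r                   ≈⟨ *-identityˡ (v r) ⟩
    v r                        ∎

  inverse-⋆ : ∀ {A B : Mat F n} → A · B ≋ idMat F → ∀ v → A ⋆ (B ⋆ v) ≈ᵥ v
  inverse-⋆ {A = A} {B} AB≋1 v r = begin
    (A ⋆ (B ⋆ v)) r  ≈⟨ ·-⋆ A B v r ⟨
    ((A · B) ⋆ v) r  ≈⟨ ⋆-congˡ v AB≋1 r ⟩
    (idMat F ⋆ v) r  ≈⟨ idMat-⋆ v r ⟩
    v r              ∎

  ⋆-0ᵥ : ∀ (M : Mat F n) {v} → v ≈ᵥ 0ᵥ → M ⋆ v ≈ᵥ 0ᵥ
  ⋆-0ᵥ M {v} v≈0 r = sum-zero _ λ t → trans (*-congˡ (v≈0 t)) (zeroʳ (M r t))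

  ⊟-⋆ : ∀ (M N : Mat F n) v → (M ⊟ N) ⋆ v ≈ᵥ (M ⋆ v) ⊖ (N ⋆ v)
  ⊟-⋆ M N v r = trans (sum-cong-≋ λ t → [y-z]x≈yx-zx (v t) (M r t) (N r t))
                      (sum-sub (λ t → M r t * v t) (λ t → N r t * v t))

  ⋆-⊖ : ∀ (M : Mat F n) u v → M ⋆ (u ⊖ v) ≈ᵥ (M ⋆ u) ⊖ (M ⋆ v)
  ⋆-⊖ M u v r = trans (sum-cong-≋ λ t → x[y-z]≈xy-xz (M r t) (u t) (v t))
                      (sum-sub (λ t → M r t * u t) (λ t → M r t * v t))

  ⋆-⊙ : ∀ (M : Mat F n) a v → M ⋆ (a ⊙ v) ≈ᵥ a ⊙ (M ⋆ v)
  ⋆-⊙ M a v r = trans (sum-cong-≋ λ t → x∙yz≈y∙xz (M r t) a (v t)) (sym (*-distribˡ-sum a (λ t → M r t * v t)))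

  Supported : ℕ → Vect F n → Set ℓ
  Supported k v = ∀ j → k ≤ toℕ j → v j ≈ 0#

  basis-supported : ∀ (t : Fin n) → Supported (suc (toℕ t)) (basis t)
  basis-supported t j t<j = δ-off λ j≡t → ℕ.<-irrefl (≡.cong toℕ (≡.sym j≡t)) t<j

  supported-mono : ∀ {k k′} {v : Vect F n} → k ≤ k′ → Supported k v → Supported k′ v
  supported-mono k≤k′ v-supp j k′≤j = v-supp j (ℕ.≤-trans k≤k′ k′≤j)

  supported-cong : ∀ {k} {u v : Vect F n} → u ≈ᵥ v → Supported k u → Supported k v
  supported-cong u≈v u-supp j k≤j = trans (sym (u≈v j)) (u-supp j k≤j)

  span-idMat⇔supported : ∀ k (v : Vect F n) → InSpanFirstCols F (idMat F) k v ⇔ Supported k v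
  span-idMat⇔supported k v = mk⇔
    (λ (coeff , coeff-supp , v≈) → supported-cong (λ r → sym (trans (v≈ r) (idMat-⋆ coeff r))) coeff-supp)
    (λ v-supp → v , v-supp , λ r → sym (idMat-⋆ v r))

  span-cong : ∀ {g : Mat F n} {k u v} → u ≈ᵥ v → InSpanFirstCols F g k u → InSpanFirstCols F g k v
  span-cong u≈v (coeff , coeff-supp , u≈g⋆coeff) = coeff , coeff-supp , λ r → trans (sym (u≈v r)) (u≈g⋆coeff r)

  upperTriangular-supported : ∀ {T : Mat F n} {k v} → UpperTriangular F T → Supported k v → Supported k (T ⋆ v)
  upperTriangular-supported {T = T} {v = v} T-upper v-supp r k≤r = sum-zero _ term
    where
    term : ∀ t → T r t * v t ≈ 0#
    term t with toℕ t ℕ.<? toℕ r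
    ... | yes t<r = trans (*-congʳ (T-upper r t t<r)) (zeroˡ (v t))
    ... | no t≮r  = trans (*-congˡ (v-supp t (ℕ.≤-trans k≤r (ℕ.≮⇒≥ t≮r)))) (zeroʳ (T r t))

  -- Row r of h vanishes below the diagonal once all later rows do: (T h) r s = T r r * h r s for s ≤ r.
  upperTriangular-inverse : ∀ {T h : Mat F n} → UpperTriangular F T → T · h ≋ idMat F → UpperTriangular F h
  upperTriangular-inverse {T = T} {h} T-upper Th≋1 r = belowDiagonal (>-wellFounded r)
    where
    belowDiagonal : ∀ {r} → Acc _>_ r → ∀ s → toℕ s < toℕ r → h r s ≈ 0#
    belowDiagonal {r} (acc later) s s<r = begin
      h r s                    ≈⟨ *-identityˡ (h r s) ⟨
      1# * h r s               ≈⟨ *-congʳ (trans (*-comm (h r r) (T r r)) (trans (row r ℕ.≤-refl) (δ-diag r))) ⟨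
      h r r * T r r * h r s    ≈⟨ *-assoc (h r r) (T r r) (h r s) ⟩
      h r r * (T r r * h r s)  ≈⟨ *-congˡ (trans (row s (ℕ.<⇒≤ s<r)) (δ-off (ℕ.>⇒≢ s<r ∘ ≡.cong toℕ))) ⟩
      h r r * 0#               ≈⟨ zeroʳ (h r r) ⟩
      0#                       ∎
      where
      row : ∀ s → toℕ s ≤ toℕ r → T r r * h r s ≈ δ F r s
      row s s≤r = trans (sym (sum-single (λ t → T r t * h t s) r term)) (Th≋1 r s)
        where
        term : ∀ t → t ≢ r → T r t * h t s ≈ 0#
        term t t≢r with ℕ.<-cmp (toℕ t) (toℕ r)
        ... | tri< t<r _ _ = trans (*-congʳ (T-upper r t t<r)) (zeroˡ (h t s))
        ... | tri≈ _ t≡r _ = contradiction (toℕ-injective t≡r) t≢r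
        ... | tri> _ _ r<t = trans (*-congˡ (belowDiagonal (later r<t) s (ℕ.≤-<-trans s≤r r<t))) (zeroʳ (T r t))

  upperTriangular-cong : ∀ {A B : Mat F n} → A ≋ B → UpperTriangular F A → UpperTriangular F B
  upperTriangular-cong A≋B A-upper r s s<r = trans (sym (A≋B r s)) (A-upper r s s<r)

  permMatrix-⋆ : ∀ (w : Permutation′ n) v → permMatrix F w ⋆ v ≈ᵥ λ r → v (w ⟨$⟩ˡ r)
  permMatrix-⋆ w v r = begin
    sum (λ s → δ F r (w ⟨$⟩ʳ s) * v s)        ≈⟨ sum-single _ (w ⟨$⟩ˡ r) off ⟩
    δ F r (w ⟨$⟩ʳ (w ⟨$⟩ˡ r)) * v (w ⟨$⟩ˡ r)  ≈⟨ *-congʳ (trans (reflexive (≡.cong (δ F r) (inverseʳ w))) (δ-diag r)) ⟩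
    1# * v (w ⟨$⟩ˡ r)                         ≈⟨ *-identityˡ _ ⟩
    v (w ⟨$⟩ˡ r)                              ∎
    where
    off : ∀ s → s ≢ w ⟨$⟩ˡ r → δ F r (w ⟨$⟩ʳ s) * v s ≈ 0#
    off s s≢w⁻¹r = trans (*-congʳ (δ-off λ r≡ws → s≢w⁻¹r (≡.trans (≡.sym (inverseˡ w)) (≡.cong (w ⟨$⟩ˡ_) (≡.sym r≡ws)))))
      (zeroˡ (v s))

  permMatrix-injective : ∀ (w : Permutation′ n) {u v} → permMatrix F w ⋆ u ≈ᵥ permMatrix F w ⋆ v → u ≈ᵥ v
  permMatrix-injective w {u} {v} Pu≈Pv j = begin
    u j                    ≡⟨ ≡.cong u (inverseˡ w) ⟨
    u (w ⟨$⟩ˡ (w ⟨$⟩ʳ j))  ≈⟨ permMatrix-⋆ w u (w ⟨$⟩ʳ j) ⟨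
    (permMatrix F w ⋆ u) (w ⟨$⟩ʳ j)  ≈⟨ Pu≈Pv (w ⟨$⟩ʳ j) ⟩
    (permMatrix F w ⋆ v) (w ⟨$⟩ʳ j)  ≈⟨ permMatrix-⋆ w v (w ⟨$⟩ʳ j) ⟩
    v (w ⟨$⟩ˡ (w ⟨$⟩ʳ j))  ≡⟨ ≡.cong v (inverseˡ w) ⟩
    v j                    ∎

  -- reindex w Y is P⁻¹ Y P for the permutation matrix P = permMatrix F w.
  reindex : Permutation′ n → Mat F n → Mat F n
  reindex w Y j t = Y (w ⟨$⟩ʳ j) (w ⟨$⟩ʳ t)

  reindex-⋆ : ∀ (w : Permutation′ n) Y u → Y ⋆ (permMatrix F w ⋆ u) ≈ᵥ permMatrix F w ⋆ (reindex w Y ⋆ u)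
  reindex-⋆ w Y u r = begin
    sum (λ t → Y r t * (permMatrix F w ⋆ u) t)          ≈⟨ ⋆-congʳ Y (permMatrix-⋆ w u) r ⟩
    sum (λ t → Y r t * u (w ⟨$⟩ˡ t))                    ≈⟨ sum-permute _ w ⟩
    sum (λ t → Y r (w ⟨$⟩ʳ t) * u (w ⟨$⟩ˡ (w ⟨$⟩ʳ t)))  ≡⟨ sum-cong-≗ (λ t → ≡.cong (λ s → Y r (w ⟨$⟩ʳ t) * u s) (inverseˡ w)) ⟩
    sum (λ t → Y r (w ⟨$⟩ʳ t) * u t)                    ≡⟨ ≡.cong (λ x → sum (λ t → Y x (w ⟨$⟩ʳ t) * u t)) (inverseʳ w) ⟨
    (reindex w Y ⋆ u) (w ⟨$⟩ˡ r)                        ≈⟨ permMatrix-⋆ w (reindex w Y ⋆ u) r ⟨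
    (permMatrix F w ⋆ (reindex w Y ⋆ u)) r              ∎

  diagonal : (Fin n → Carrier) → Mat F n
  diagonal d x t = d x * δ F x t

  diagonal-off : ∀ d {x t : Fin n} → x ≢ t → diagonal d x t ≈ 0#
  diagonal-off d {x} x≢t = trans (*-congˡ (δ-off x≢t)) (zeroʳ (d x))

  diagonal-⋆ : ∀ d (v : Vect F n) → diagonal d ⋆ v ≈ᵥ λ x → d x * v x
  diagonal-⋆ d v x = begin
    sum (λ t → d x * δ F x t * v t)  ≈⟨ sum-single _ x off ⟩
    d x * δ F x x * v x              ≈⟨ *-congʳ (trans (*-congˡ (δ-diag x)) (*-identityʳ (d x))) ⟩
    d x * v x                        ∎
    where
    off : ∀ t → t ≢ x → d x * δ F x t * v t ≈ 0#
    off t t≢x = trans (*-congʳ (diagonal-off d (t≢x ∘ ≡.sym))) (zeroˡ (v t))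

  reindex-diagonal-upper : ∀ (w : Permutation′ n) d → UpperTriangular F (reindex w (diagonal d))
  reindex-diagonal-upper w d j t t<j = diagonal-off d λ wj≡wt →
    ℕ.>⇒≢ t<j (≡.cong toℕ (≡.trans (≡.sym (inverseˡ w)) (≡.trans (≡.cong (w ⟨$⟩ˡ_) wj≡wt) (inverseˡ w))))

  blockValue : ℕ → Carrier → Carrier → Fin n → Carrier
  blockValue I a b x with toℕ x ℕ.<? I
  ... | yes _ = a
  ... | no  _ = b

  blockValue-low : ∀ {I a b} {x : Fin n} → toℕ x < I → blockValue I a b x ≈ a
  blockValue-low {I = I} {x = x} x<I with toℕ x ℕ.<? I
  ... | yes _   = refl
  ... | no x≮I  = contradiction x<I x≮I

  blockValue-high : ∀ {I a b} {x : Fin n} → I ≤ toℕ x → blockValue I a b x ≈ b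
  blockValue-high {I = I} {x = x} I≤x with toℕ x ℕ.<? I
  ... | yes x<I = contradiction x<I (ℕ.≤⇒≯ I≤x)
  ... | no _    = refl

  blockScalar : ℕ → Carrier → Carrier → Mat F n
  blockScalar I a b = diagonal (blockValue I a b)

  blockScalar-lowColumn : ∀ {I a b} {x t : Fin n} → toℕ t < I → blockScalar I a b x t ≈ a * δ F x t
  blockScalar-lowColumn {I = I} {a} {b} {x} {t} t<I = byCases (x ≟ t)
    where
    byCases : Dec (x ≡ t) → blockScalar I a b x t ≈ a * δ F x t
    byCases (yes ≡.refl) = *-congʳ (blockValue-low t<I)
    byCases (no x≢t)     = trans (diagonal-off (blockValue I a b) x≢t) (sym (diagonal-off (λ _ → a) x≢t))

  blockScalar-highRow : ∀ {I a b} {x t : Fin n} → I ≤ toℕ x → blockScalar I a b x t ≈ b * δ F x t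
  blockScalar-highRow I≤x = *-congʳ (blockValue-high I≤x)

  blockScalar-cong : ∀ {I a a′ b b′} → a ≈ a′ → b ≈ b′ → blockScalar {n} I a b ≋ blockScalar I a′ b′
  blockScalar-cong {I = I} {a} {a′} {b} {b′} a≈a′ b≈b′ x t = *-congʳ value≈
    where
    value≈ : blockValue I a b x ≈ blockValue I a′ b′ x
    value≈ with toℕ x ℕ.<? I
    ... | yes _ = a≈a′
    ... | no  _ = b≈b′

  blockScalar-zero : ∀ {I} (x t : Fin n) → blockScalar I 0# 0# x t ≈ 0#
  blockScalar-zero {I = I} x t = trans (*-congʳ value≈0) (zeroˡ _)
    where
    value≈0 : blockValue I 0# 0# x ≈ 0#
    value≈0 with toℕ x ℕ.<? I
    ... | yes _ = refl
    ... | no  _ = refl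

  blockScalar-⋆-low : ∀ {I a b} {v : Vect F n} → Supported I v → blockScalar I a b ⋆ v ≈ᵥ a ⊙ v
  blockScalar-⋆-low {I = I} {a} {b} {v} v-supp x =
    trans (diagonal-⋆ (blockValue I a b) v x) (byCases (toℕ x ℕ.<? I))
    where
    byCases : Dec (toℕ x < I) → blockValue I a b x * v x ≈ a * v x
    byCases (yes x<I) = *-congʳ (blockValue-low x<I)
    byCases (no x≮I)  = trans (*-congˡ vx≈0) (trans (zeroʳ _) (sym (trans (*-congˡ vx≈0) (zeroʳ a))))
      where
      vx≈0 : v x ≈ 0#
      vx≈0 = v-supp x (ℕ.≮⇒≥ x≮I)

  blockScalar-⋆-high : ∀ {I a b} (v : Vect F n) → Supported I ((blockScalar I a b ⋆ v) ⊖ (b ⊙ v))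
  blockScalar-⋆-high {I = I} {a} {b} v x I≤x =
    x≈y⇒x∙y⁻¹≈ε (trans (diagonal-⋆ (blockValue I a b) v x) (*-congʳ (blockValue-high I≤x)))

  StrictlyBlockUpper : ℕ → Mat F n → Set ℓ
  StrictlyBlockUpper I N = ∀ x t → toℕ t < I ⊎ I ≤ toℕ x → N x t ≈ 0#

  blockUpper-kills : ∀ {I} {N : Mat F n} {v} → StrictlyBlockUpper I N → Supported I v → N ⋆ v ≈ᵥ 0ᵥ
  blockUpper-kills {I = I} {N} {v} N-upper v-supp x = sum-zero _ term
    where
    term : ∀ t → N x t * v t ≈ 0#
    term t with toℕ t ℕ.<? I
    ... | yes t<I = trans (*-congʳ (N-upper x t (inj₁ t<I))) (zeroˡ (v t))
    ... | no t≮I  = trans (*-congˡ (v-supp t (ℕ.≮⇒≥ t≮I))) (zeroʳ (N x t))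

  blockUpper-lands : ∀ {I} {N : Mat F n} v → StrictlyBlockUpper I N → Supported I (N ⋆ v)
  blockUpper-lands v N-upper x I≤x = sum-zero _ λ t → trans (*-congʳ (N-upper x t (inj₂ I≤x))) (zeroˡ (v t))

  upperTriangular-conj-blockUpper : ∀ {I} {A N B : Mat F n} → UpperTriangular F A → UpperTriangular F B →
                                    StrictlyBlockUpper I N → StrictlyBlockUpper I (A · (N · B))
  upperTriangular-conj-blockUpper {I = I} {A} {N} {B} A-upper B-upper N-upper x t position =
    trans (sym (⋆-basis (A · (N · B)) t x)) (trans (·-·-⋆ A N B (basis t) x) (vanishes position))
    where
    vanishes : toℕ t < I ⊎ I ≤ toℕ x → (A ⋆ (N ⋆ (B ⋆ basis t))) x ≈ 0#
    vanishes (inj₁ t<I) = ⋆-0ᵥ A (blockUpper-kills N-upper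
      (upperTriangular-supported B-upper (supported-mono t<I (basis-supported t)))) x
    vanishes (inj₂ I≤x) = upperTriangular-supported A-upper (blockUpper-lands (B ⋆ basis t) N-upper) x I≤x

  blockUpper-⊟ : ∀ {I} {M M′ D D′ : Mat F n} → StrictlyBlockUpper I (M ⊟ D) → StrictlyBlockUpper I (M′ ⊟ D′) →
                 D ≋ D′ → StrictlyBlockUpper I (M ⊟ M′)
  blockUpper-⊟ M-upper M′-upper D≋D′ x t position = x≈y⇒x∙y⁻¹≈ε (begin
    _      ≈⟨ x∙y⁻¹≈ε⇒x≈y _ _ (M-upper x t position) ⟩
    _      ≈⟨ D≋D′ x t ⟩
    _      ≈⟨ x∙y⁻¹≈ε⇒x≈y _ _ (M′-upper x t position) ⟨
    _      ∎)

  blockUpper-⊟-zero : ∀ {I} {N Z : Mat F n} → StrictlyBlockUpper I N → (∀ x t → Z x t ≈ 0#) →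
                      StrictlyBlockUpper I (N ⊟ Z)
  blockUpper-⊟-zero N-upper Z≈0 x t position =
    trans (+-cong (N-upper x t position) (-‿cong (Z≈0 x t))) (-‿inverseʳ 0#)

  elementary : Fin n → Fin n → Mat F n
  elementary r s x t = δ F x r * δ F t s

  elementary-diag : ∀ (r s : Fin n) → elementary r s r s ≈ 1#
  elementary-diag r s = trans (*-cong (δ-diag r) (δ-diag s)) (*-identityˡ 1#)

  elementary-blockUpper : ∀ {I} {r s : Fin n} → toℕ r < I → I ≤ toℕ s → StrictlyBlockUpper I (elementary r s)
  elementary-blockUpper r<I I≤s x t (inj₁ t<I) =
    trans (*-congˡ (δ-off λ t≡s → ℕ.<⇒≱ (≡.subst (λ u → toℕ u < _) t≡s t<I) I≤s)) (zeroʳ _)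
  elementary-blockUpper r<I I≤s x t (inj₂ I≤x) =
    trans (*-congʳ (δ-off λ x≡r → ℕ.<⇒≱ (≡.subst (λ u → toℕ u < _) (≡.sym x≡r) r<I) I≤x)) (zeroˡ _)

  elementary-upper : ∀ (w : Permutation′ n) {r s} → ¬ toℕ (w ⟨$⟩ˡ s) < toℕ (w ⟨$⟩ˡ r) →
                     UpperTriangular F (reindex w (elementary r s))
  elementary-upper w {r} {s} s≮r j t t<j = byCases (w ⟨$⟩ʳ j ≟ r) (w ⟨$⟩ʳ t ≟ s)
    where
    at : ∀ {k a} → w ⟨$⟩ʳ k ≡ a → k ≡ w ⟨$⟩ˡ a
    at wk≡a = ≡.trans (≡.sym (inverseˡ w)) (≡.cong (w ⟨$⟩ˡ_) wk≡a)
    byCases : Dec (w ⟨$⟩ʳ j ≡ r) → Dec (w ⟨$⟩ʳ t ≡ s) → reindex w (elementary r s) j t ≈ 0#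
    byCases (no wj≢r)  _          = trans (*-congʳ (δ-off wj≢r)) (zeroˡ _)
    byCases (yes _)    (no wt≢s)  = trans (*-congˡ (δ-off wt≢s)) (zeroʳ _)
    byCases (yes wj≡r) (yes wt≡s) = contradiction (≡.subst₂ (λ a b → toℕ a < toℕ b) (at wt≡s) (at wj≡r) t<j) s≮r

  exchangesBlocks⇒blockUpper∩upper≡0 : ∀ {I} {w : Permutation′ n} {Y} → ExchangesBlocks I w →
    StrictlyBlockUpper I Y → UpperTriangular F (reindex w Y) → ∀ x t → Y x t ≈ 0#
  exchangesBlocks⇒blockUpper∩upper≡0 {I = I} {w} {Y} exchanges Y-blockUpper Y-upper x t
    with toℕ t ℕ.<? I | toℕ x ℕ.<? I
  ... | yes t<I | _       = Y-blockUpper x t (inj₁ t<I)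
  ... | no _    | no x≮I  = Y-blockUpper x t (inj₂ (ℕ.≮⇒≥ x≮I))
  ... | no t≮I  | yes x<I = begin
    Y x t                                      ≡⟨ ≡.cong₂ Y (inverseʳ w) (inverseʳ w) ⟨
    Y (w ⟨$⟩ʳ (w ⟨$⟩ˡ x)) (w ⟨$⟩ʳ (w ⟨$⟩ˡ t))  ≈⟨ Y-upper (w ⟨$⟩ˡ x) (w ⟨$⟩ˡ t) (exchanges x t x<I (ℕ.≮⇒≥ t≮I)) ⟩
    0#                                         ∎

  preservesFlag-⊟ : ∀ {g M M′ : Mat F n} → PreservesFlag F g M → PreservesFlag F g M′ → PreservesFlag F g (M ⊟ M′)
  preservesFlag-⊟ {g = g} {M} {M′} M-flag M′-flag k 1≤k k≤n v v∈flag
    with M-flag k 1≤k k≤n v v∈flag | M′-flag k 1≤k k≤n v v∈flag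
  ... | c , c-supp , Mv≈gc | c′ , c′-supp , M′v≈gc′ =
    c ⊖ c′ ,
    (λ j k≤j → trans (+-cong (c-supp j k≤j) (-‿cong (c′-supp j k≤j))) (-‿inverseʳ 0#)) ,
    (λ r → trans (⊟-⋆ M M′ v r) (trans (+-cong (Mv≈gc r) (-‿cong (M′v≈gc′ r))) (sym (⋆-⊖ g c c′ r))))

  inHomI⇔ : ∀ {g M : Mat F n} {I a b} →
            InHomI F g I M a b ⇔ (PreservesFlag F g M × StrictlyBlockUpper I (M ⊟ blockScalar I a b))
  inHomI⇔ {g = g} {M} {I} {a} {b} = mk⇔
    (λ (M-flag , lowColumns , highColumns) → M-flag , blockUpper lowColumns highColumns)
    (λ (M-flag , M-upper) → M-flag ,
      (λ t t<I x → trans (x∙y⁻¹≈ε⇒x≈y _ _ (M-upper x t (inj₁ t<I))) (blockScalar-lowColumn t<I)) ,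
      (λ t I≤t → Equivalence.from (span-idMat⇔supported I _) λ x I≤x →
        trans (+-congˡ (-‿cong (sym (blockScalar-highRow I≤x)))) (M-upper x t (inj₂ I≤x))))
    where
    blockUpper : (∀ t → toℕ t < I → ∀ x → M x t ≈ a * δ F x t) →
                 (∀ t → I ≤ toℕ t → InSpanFirstCols F (idMat F) I (λ x → M x t - b * δ F x t)) →
                 StrictlyBlockUpper I (M ⊟ blockScalar I a b)
    blockUpper lowColumns highColumns x t position with toℕ t ℕ.<? I | position
    ... | yes t<I | _        = x≈y⇒x∙y⁻¹≈ε (trans (lowColumns t t<I x) (sym (blockScalar-lowColumn t<I)))
    ... | no t≮I  | inj₁ t<I = contradiction t<I t≮I
    ... | no t≮I  | inj₂ I≤x = trans (+-congˡ (-‿cong (blockScalar-highRow I≤x)))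
      (Equivalence.to (span-idMat⇔supported I _) (highColumns t (ℕ.≮⇒≥ t≮I)) x I≤x)

  module BruhatCell {n} (g : Mat F n) (w : Permutation′ n) (b₁ h₁ b₂ h₂ : Mat F n)
    (b₁-upper : UpperTriangular F b₁) (b₁h₁ : b₁ · h₁ ≋ idMat F) (h₁b₁ : h₁ · b₁ ≋ idMat F)
    (b₂-upper : UpperTriangular F b₂) (b₂h₂ : b₂ · h₂ ≋ idMat F)
    (g≋b₁Pb₂ : g ≋ b₁ · (permMatrix F w · b₂)) where

    private
      P : Mat F n
      P = permMatrix F w
      h₁-upper : UpperTriangular F h₁
      h₁-upper = upperTriangular-inverse b₁-upper b₁h₁
      h₂-upper : UpperTriangular F h₂
      h₂-upper = upperTriangular-inverse b₂-upper b₂h₂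

    g-⋆ : ∀ c → g ⋆ c ≈ᵥ b₁ ⋆ (P ⋆ (b₂ ⋆ c))
    g-⋆ c r = trans (⋆-congˡ c g≋b₁Pb₂ r) (·-·-⋆ b₁ P b₂ c r)

    flag-of-supported : ∀ {k u} → Supported k u → InSpanFirstCols F g k (b₁ ⋆ (P ⋆ u))
    flag-of-supported {u = u} u-supp = h₂ ⋆ u , upperTriangular-supported h₂-upper u-supp ,
      λ r → sym (trans (g-⋆ (h₂ ⋆ u) r) (⋆-congʳ b₁ (⋆-congʳ P (inverse-⋆ b₂h₂ u)) r))

    supported-of-flag : ∀ {k v} → InSpanFirstCols F g k v → Σ (Vect F n) λ u → Supported k u × h₁ ⋆ v ≈ᵥ P ⋆ u
    supported-of-flag (c , c-supp , v≈gc) = b₂ ⋆ c , upperTriangular-supported b₂-upper c-supp ,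
      λ r → trans (⋆-congʳ h₁ (λ r′ → trans (v≈gc r′) (g-⋆ c r′)) r) (inverse-⋆ h₁b₁ (P ⋆ (b₂ ⋆ c)) r)

    -- reindex w (conj M) is the matrix of M in the basis b₁ P e of the flag.
    conj : Mat F n → Mat F n
    conj M = h₁ · (M · b₁)

    unconj : Mat F n → Mat F n
    unconj Y = b₁ · (Y · h₁)

    conj-cong : ∀ {M M′} → M ≋ M′ → conj M ≋ conj M′
    conj-cong {M} {M′} M≋M′ = ≋-by-columns λ t r → trans (·-·-⋆ h₁ M b₁ (basis t) r)
      (trans (⋆-congʳ h₁ (⋆-congˡ (b₁ ⋆ basis t) M≋M′) r) (sym (·-·-⋆ h₁ M′ b₁ (basis t) r)))

    conj-unconj : ∀ Y → conj (unconj Y) ≋ Y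
    conj-unconj Y = ≋-by-columns λ t r → begin
      (conj (unconj Y) ⋆ basis t) r                ≈⟨ ·-·-⋆ h₁ (unconj Y) b₁ (basis t) r ⟩
      (h₁ ⋆ (unconj Y ⋆ (b₁ ⋆ basis t))) r         ≈⟨ ⋆-congʳ h₁ (·-·-⋆ b₁ Y h₁ (b₁ ⋆ basis t)) r ⟩
      (h₁ ⋆ (b₁ ⋆ (Y ⋆ (h₁ ⋆ (b₁ ⋆ basis t))))) r  ≈⟨ inverse-⋆ h₁b₁ _ r ⟩
      (Y ⋆ (h₁ ⋆ (b₁ ⋆ basis t))) r                ≈⟨ ⋆-congʳ Y (inverse-⋆ h₁b₁ (basis t)) r ⟩
      (Y ⋆ basis t) r                              ∎

    conj-vanishes : ∀ {N} → (∀ x t → conj N x t ≈ 0#) → ∀ x t → N x t ≈ 0#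
    conj-vanishes {N} conjN≈0 x t = begin
      N x t                                        ≈⟨ ⋆-basis N t x ⟨
      (N ⋆ basis t) x                              ≈⟨ inverse-⋆ b₁h₁ (N ⋆ basis t) x ⟨
      (b₁ ⋆ (h₁ ⋆ (N ⋆ basis t))) x                ≈⟨ ⋆-congʳ b₁ (⋆-congʳ h₁ (⋆-congʳ N (inverse-⋆ b₁h₁ (basis t)))) x ⟨
      (b₁ ⋆ (h₁ ⋆ (N ⋆ (b₁ ⋆ (h₁ ⋆ basis t))))) x  ≈⟨ ⋆-congʳ b₁ (·-·-⋆ h₁ N b₁ (h₁ ⋆ basis t)) x ⟨
      (b₁ ⋆ (conj N ⋆ (h₁ ⋆ basis t))) x           ≈⟨ ⋆-0ᵥ b₁ (λ r → sum-zero _ (vanishing r)) x ⟩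
      0#                                           ∎
      where
      vanishing : ∀ r u → conj N r u * (h₁ ⋆ basis t) u ≈ 0#
      vanishing r u = trans (*-congʳ (conjN≈0 r u)) (zeroˡ _)

    preservesFlag⇔ : ∀ {M} → PreservesFlag F g M ⇔ UpperTriangular F (reindex w (conj M))
    preservesFlag⇔ {M} = mk⇔ upper preserves
      where
      upper : PreservesFlag F g M → UpperTriangular F (reindex w (conj M))
      upper M-flag j t t<j
        with supported-of-flag (M-flag (suc (toℕ t)) (s≤s z≤n) (toℕ<n t) _ (flag-of-supported (basis-supported t)))
      ... | u , u-supp , h₁Mv≈Pu = begin
        reindex w (conj M) j t            ≈⟨ ⋆-basis (reindex w (conj M)) t j ⟨
        (reindex w (conj M) ⋆ basis t) j  ≈⟨ permMatrix-injective w column j ⟩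
        u j                               ≈⟨ u-supp j t<j ⟩
        0#                                ∎
        where
        column : P ⋆ (reindex w (conj M) ⋆ basis t) ≈ᵥ P ⋆ u
        column r = trans (sym (reindex-⋆ w (conj M) (basis t) r))
                         (trans (·-·-⋆ h₁ M b₁ (P ⋆ basis t) r) (h₁Mv≈Pu r))
      preserves : UpperTriangular F (reindex w (conj M)) → PreservesFlag F g M
      preserves conjM-upper k _ _ v v∈flag with supported-of-flag v∈flag
      ... | u , u-supp , h₁v≈Pu = span-cong Mv≈ (flag-of-supported (upperTriangular-supported conjM-upper u-supp))
        where
        Mv≈ : b₁ ⋆ (P ⋆ (reindex w (conj M) ⋆ u)) ≈ᵥ M ⋆ v
        Mv≈ r = begin
          (b₁ ⋆ (P ⋆ (reindex w (conj M) ⋆ u))) r  ≈⟨ ⋆-congʳ b₁ (reindex-⋆ w (conj M) u) r ⟨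
          (b₁ ⋆ (conj M ⋆ (P ⋆ u))) r              ≈⟨ ⋆-congʳ b₁ (⋆-congʳ (conj M) h₁v≈Pu) r ⟨
          (b₁ ⋆ (conj M ⋆ (h₁ ⋆ v))) r             ≈⟨ ⋆-congʳ b₁ (·-·-⋆ h₁ M b₁ (h₁ ⋆ v)) r ⟩
          (b₁ ⋆ (h₁ ⋆ (M ⋆ (b₁ ⋆ (h₁ ⋆ v))))) r    ≈⟨ inverse-⋆ b₁h₁ (M ⋆ (b₁ ⋆ (h₁ ⋆ v))) r ⟩
          (M ⋆ (b₁ ⋆ (h₁ ⋆ v))) r                  ≈⟨ ⋆-congʳ M (inverse-⋆ b₁h₁ v) r ⟩
          (M ⋆ v) r                                ∎

    unconj-inKernel : ∀ {I Y} → UpperTriangular F (reindex w Y) → StrictlyBlockUpper I Y →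
                      InHomI F g I (unconj Y) 0# 0#
    unconj-inKernel {I} {Y} Y-upper Y-blockUpper = Equivalence.from inHomI⇔
      ( Equivalence.from preservesFlag⇔ (upperTriangular-cong (λ j t → sym (conj-unconj Y _ _)) Y-upper)
      , blockUpper-⊟-zero (upperTriangular-conj-blockUpper b₁-upper h₁-upper Y-blockUpper) blockScalar-zero)

    unconj-blockScalar-inHomI : ∀ I a b → InHomI F g I (unconj (blockScalar I a b)) a b
    unconj-blockScalar-inHomI I a b = Equivalence.from inHomI⇔ (flag , blockUpper)
      where
      D : Mat F n
      D = blockScalar I a b
      flag : PreservesFlag F g (unconj D)
      flag = Equivalence.from preservesFlag⇔ (upperTriangular-cong
        (λ j t → sym (conj-unconj D (w ⟨$⟩ʳ j) (w ⟨$⟩ʳ t))) (reindex-diagonal-upper w (blockValue I a b)))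
      h₁e : Fin n → Vect F n
      h₁e t = h₁ ⋆ basis t
      entry : ∀ x t → (unconj D ⊟ D) x t ≈ (b₁ ⋆ (D ⋆ h₁e t)) x - (D ⋆ basis t) x
      entry x t = trans (sym (⋆-basis (unconj D ⊟ D) t x))
        (trans (⊟-⋆ (unconj D) D (basis t) x) (+-congʳ (·-·-⋆ b₁ D h₁ (basis t) x)))
      blockUpper : StrictlyBlockUpper I (unconj D ⊟ D)
      blockUpper x t (inj₁ t<I) = trans (entry x t) (x≈y⇒x∙y⁻¹≈ε (begin
        (b₁ ⋆ (D ⋆ h₁e t)) x  ≈⟨ ⋆-congʳ b₁ (blockScalar-⋆-low (upperTriangular-supported h₁-upper t-supp)) x ⟩
        (b₁ ⋆ (a ⊙ h₁e t)) x  ≈⟨ ⋆-⊙ b₁ a (h₁e t) x ⟩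
        a * (b₁ ⋆ h₁e t) x    ≈⟨ *-congˡ (inverse-⋆ b₁h₁ (basis t) x) ⟩
        a * basis t x         ≈⟨ blockScalar-⋆-low t-supp x ⟨
        (D ⋆ basis t) x       ∎))
        where
        t-supp : Supported I (basis t)
        t-supp = supported-mono t<I (basis-supported t)
      blockUpper x t (inj₂ I≤x) = trans (entry x t) (begin
        (b₁ ⋆ (D ⋆ h₁e t)) x - (D ⋆ basis t) x       ≈⟨ +-congˡ (-‿cong Dt≈) ⟩
        (b₁ ⋆ (D ⋆ h₁e t)) x - (b₁ ⋆ (b ⊙ h₁e t)) x  ≈⟨ ⋆-⊖ b₁ (D ⋆ h₁e t) (b ⊙ h₁e t) x ⟨
        (b₁ ⋆ ((D ⋆ h₁e t) ⊖ (b ⊙ h₁e t))) x         ≈⟨ upperTriangular-supported b₁-upper (blockScalar-⋆-high (h₁e t)) x I≤x ⟩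
        0#                                           ∎)
        where
        Dt≈ : (D ⋆ basis t) x ≈ (b₁ ⋆ (b ⊙ h₁e t)) x
        Dt≈ = begin
          (D ⋆ basis t) x                 ≈⟨ diagonal-⋆ (blockValue I a b) (basis t) x ⟩
          blockValue I a b x * basis t x  ≈⟨ *-cong (blockValue-high I≤x) (sym (inverse-⋆ b₁h₁ (basis t) x)) ⟩
          b * (b₁ ⋆ h₁e t) x              ≈⟨ ⋆-⊙ b₁ b (h₁e t) x ⟨
          (b₁ ⋆ (b ⊙ h₁e t)) x            ∎

    exchangesBlocks⇒injective : ∀ {I} → ExchangesBlocks I w → ∀ M M′ a b a′ b′ →
      InHomI F g I M a b → InHomI F g I M′ a′ b′ → a ≈ a′ → b ≈ b′ → M ≋ M′
    exchangesBlocks⇒injective exchanges M M′ a b a′ b′ M-hom M′-hom a≈a′ b≈b′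
      with Equivalence.to inHomI⇔ M-hom | Equivalence.to inHomI⇔ M′-hom
    ... | M-flag , M-upper | M′-flag , M′-upper = λ x t → x∙y⁻¹≈ε⇒x≈y _ _ (conj-vanishes
      (exchangesBlocks⇒blockUpper∩upper≡0 {w = w} exchanges
        (upperTriangular-conj-blockUpper h₁-upper b₁-upper (blockUpper-⊟ M-upper M′-upper (blockScalar-cong a≈a′ b≈b′)))
        (Equivalence.to preservesFlag⇔ (preservesFlag-⊟ M-flag M′-flag))) x t)

    isomorphism⇔exchangesBlocks : ∀ I → FIsIsomorphism F g I ⇔ ExchangesBlocks I w
    isomorphism⇔exchangesBlocks I = mk⇔ exchanges
      (λ exchanges → exchangesBlocks⇒injective exchanges , λ a b → _ , unconj-blockScalar-inHomI I a b)
      where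
      -- Otherwise the elementary matrix E_rs gives a nonzero element of the kernel.
      exchanges : FIsIsomorphism F g I → ExchangesBlocks I w
      exchanges (injective , _) r s r<I I≤s with toℕ (w ⟨$⟩ˡ s) ℕ.<? toℕ (w ⟨$⟩ˡ r)
      ... | yes s<r = s<r
      ... | no s≮r  = contradiction (begin
          1#                    ≈⟨ elementary-diag r s ⟨
          E r s                 ≈⟨ conj-unconj E r s ⟨
          conj (unconj E) r s   ≈⟨ conj-cong E≋0 r s ⟩
          conj (unconj 0ₘ) r s  ≈⟨ conj-unconj 0ₘ r s ⟩
          0#                    ∎) (0≉1 ∘ sym)
        where
        E 0ₘ : Mat F n
        E = elementary r s
        0ₘ _ _ = 0#
        E≋0 : unconj E ≋ unconj 0ₘ
        E≋0 = injective _ _ 0# 0# 0# 0#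
          (unconj-inKernel (elementary-upper w s≮r) (elementary-blockUpper r<I I≤s))
          (unconj-inKernel (λ _ _ _ → refl) (λ _ _ _ → refl)) refl refl

proposition2p5p1 : ∀ {c ℓ} (F : Field c ℓ) {m} (g : Mat F (suc m)) (w : Permutation′ (suc m))
    (i : Fin m) → Invertible F g → InBruhatCell F g w →
    (FIsIsomorphism F g (suc (toℕ i)) ⇔
      Σ (List (Fin m)) (λ ws → IsReducedExpression ws (λ k → w ⟨$⟩ʳ w₀ k) × ¬ (i ∈ ws)))
    × (FIsIsomorphism F g (suc (toℕ i)) ⇔
      (∀ (ws : List (Fin m)) → IsReducedExpression ws (λ k → w ⟨$⟩ʳ w₀ k) → ¬ (i ∈ ws)))
proposition2p5p1 F g w i _ (b₁ , b₂ , b₁-upper , (h₁ , b₁h₁ , h₁b₁) , b₂-upper , (h₂ , b₂h₂ , _) , g≋b₁Pb₂) =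
  stabilises⇔some-reduced-avoids π i ⇔-∘ isomorphism⇔stabilises ,
  stabilises⇔every-reduced-avoids π i ⇔-∘ isomorphism⇔stabilises
  where
  open Permutations
  open Matrices.BruhatCell F g w b₁ h₁ b₂ h₂ b₁-upper b₁h₁ h₁b₁ b₂-upper b₂h₂ g≋b₁Pb₂
  π : Permutation′ _
  π = reverse ∘ₚ w
  isomorphism⇔stabilises : FIsIsomorphism F g (suc (toℕ i)) ⇔ Stabilises (suc (toℕ i)) π
  isomorphism⇔stabilises = exchangesBlocks⇔stabilises w ⇔-∘ isomorphism⇔exchangesBlocks (suc (toℕ i))
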